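{- Let $n\ge r\ge0$ and $R\in\mathrm{RAT}^+(n+1,r+1)$ with diagonal strip labels $1=d_1<\cdots<d_{r+1}$. Write $e(\Phi_I(R))=B_1\,\epsilon_1\,B_2\,\epsilon_2\cdots B_{r+1}\,\epsilon_{r+1}\,B_{r+2}$, and for $i\in[r+1]$ let $(X_i,Y_i,d_i)$ be the decomposition of $B_i$. Then the number of up-arrows in the diagonal strip $d_i$ equals $\mathrm{RLmax}(X_i)$, the number of left-arrows in it equals $\mathrm{RLmin}(Y_i)$, and so the total number of arrows in the diagonal strip $d_i$ is $\mathrm{RLmax}(X_i)+\mathrm{RLmin}(Y_i)$.
   Context: Rhombic diagrams and RAT. For $w=w_1\cdots w_m\in\{0,1,2\}^m$, the rhombic diagram $\Gamma_w$ is the region between the southeast border (reading $w$ left to right: a unit step south for $2$, southwest (vector $(-1,-1)$) for $1$, west for $0$) and the northwest border from the same start ((number of $0$'s) steps west, then (number of $1$'s) southwest, then (number of $2$'s) south), tiled by squares, tall rhombi and short rhombi via the maximal tiling (if no $i$ has $w_i>w_{i+1}$ nothing is tiled; otherwise for the smallest such $i$, tile the region of the word with $w_i,w_{i+1}$ swapped and add a tall rhombus, square or short rhombus according as $(w_i,w_{i+1})=(2,1),(2,0),(1,0)$). Border edges are labeled $1,\dots,m$ from northeast to southwest; each starts a strip (maximal sequence of tiles connected through parallel edges) with its label: rows from vertical edges, columns from horizontal edges, diagonal strips from diagonal edges; for $i<j$ the cell $(i,j)$ is the tile in strips $i,j$. A RAT is a filling of some tiles with up-arrows (only in tiles of a column)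 and left-arrows (only in tiles of a row) such that no arrow lies in a cell pointed to by another arrow; a left-arrow points to all other cells of its row to its west, an up-arrow to all other cells of its column to its north. A free row has no left-arrow. $\mathrm{RAT}^+(n+1,r+1)$: RAT labeled by $[n+1]$ with $r+1$ diagonal steps, first step diagonal, every column containing an up-arrow. Assemblées and $\epsilon$-words. $\mathcal{A}(n+1,r+1)$ is the set of sets of $r+1$ permutations (words) of the blocks of a set partition of $[n+1]$ into $r+1$ blocks. Fix symbols $\epsilon_1<\cdots<\epsilon_{r+1}<1<\cdots<n+1$. For $\pi\in\mathcal{A}(n+1,r+1)$ order its blocks $B_1,\dots,B_{r+1}$ with $1\in B_1$ and the last letters of $B_2,\dots,B_{r+1}$ increasing; write $B_1=C_1\,1\,C_2$; $e(\pi)=C_1\,1\,\epsilon_1\,B_2\,\epsilon_2\cdots B_{r+1}\,\epsilon_{r+1}\,C_2$. For such a word $v=B_1\epsilon_1\cdots B_{r+1}\epsilon_{r+1}B_{r+2}$, $e^{ -1}(v)$ is the assemblée with blocks $B_1B_{r+2}$, $B_2,\dots,B_{r+1}$. Insertion map $\Phi_I$. For $R\in\mathrm{RAT}^+(n+1,r+1)$ with diagonal labels $d_1<\cdots<d_{r+1}$ and free row labels $a_1<\cdots<a_t$, start with $v=\epsilon_1\cdots\epsilon_{r+1}a_1\cdots a_t$. Process the column and diagonal strips in decreasing order of label: for strip $\ell$, let $r_1<\cdots<r_k$ be the labels of the strips meeting strip $\ell$ in a cell containing a left-arrow; let $j=h$ if $\ell$ is a column with its up-arrow in row $h$, $j=\epsilon_t$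 if $\ell$ is a column with its up-arrow in diagonal strip $d_t$, and $j=\epsilon_t$ if $\ell=d_t$; insert $r_1\cdots r_k\,\ell$ immediately left of $j$. Then $\Phi_I(R)=e^{ -1}(v)$, so $e(\Phi_I(R))=v$. Word statistics. For a word $u$ of distinct integers, $\mathrm{RLmax}(u)$ ($\mathrm{RLmin}(u)$) is the number of letters larger (smaller) than all letters to their right; both are $0$ for the empty word. The decomposition of a nonempty word $B=b_1\cdots b_k$ is the triple $(X,Y,b_k)$ where, with $t$ the largest index in $[1,k-1]$ with $b_t>b_k$, $X=b_1\cdots b_t$ and $Y=b_{t+1}\cdots b_{k-1}$; if no such $t$ exists, $X$ is empty and $Y=b_1\cdots b_{k-1}$. -}

module Defs where

open import Data.Nat using (ℕ; zero; suc; _+_; _*_; _≤_; _<ᵇ_; _≤ᵇ_; _≡ᵇ_)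
open import Data.Bool using (Bool; true; false; if_then_else_; _∧_; _∨_; not)
open import Data.List using (List; []; _∷_; _++_; length; map; reverse; foldl; applyUpTo)
open import Data.List.Membership.Propositional using (_∈_)
open import Data.Maybe using (Maybe; just; nothing)
open import Data.Product using (_×_; _,_; proj₁; proj₂; ∃; ∃-syntax)
open import Data.Sum using (_⊎_)
open import Relation.Nullary using (¬_)
open import Relation.Binary.PropositionalEquality using (_≡_)

select : {A : Set} → (A → Bool) → List A → List A
select p [] = []
select p (x ∷ xs) = if p x then x ∷ select p xs else select p xs

anyB : {A : Set} → (A → Bool) → List A → Bool
anyB p [] = false
anyB p (x ∷ xs) = p x ∨ anyB p xs

allB : {A : Set} → (A → Bool) → List A → Bool
allB p [] = true
allB p (x ∷ xs) = p x ∧ allB p xs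

takeWhileB : {A : Set} → (A → Bool) → List A → List A
takeWhileB p [] = []
takeWhileB p (x ∷ xs) = if p x then x ∷ takeWhileB p xs else []

dropWhileB : {A : Set} → (A → Bool) → List A → List A
dropWhileB p [] = []
dropWhileB p (x ∷ xs) = if p x then dropWhileB p xs else x ∷ xs

firstB : (ℕ → Bool) → List ℕ → Maybe ℕ
firstB p [] = nothing
firstB p (x ∷ xs) = if p x then just x else firstB p xs

-- 1-based indexing with a default (only used in range)
nth : {A : Set} → A → List A → ℕ → A
nth d [] _ = d
nth d (x ∷ xs) zero = d
nth d (x ∷ xs) (suc zero) = x
nth d (x ∷ xs) (suc (suc k)) = nth d xs (suc k)

lastL : {A : Set} → List A → Maybe A
lastL [] = nothing
lastL (x ∷ []) = just x
lastL (x ∷ y ∷ xs) = lastL (y ∷ xs)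

labels : ℕ → List ℕ
labels m = applyUpTo suc m

data Step : Set where
  s0 s1 s2 : Step   -- 0 = west step (column), 1 = southwest (diagonal), 2 = south (row)

rank : Step → ℕ
rank s0 = 0
rank s1 = 1
rank s2 = 2

isS0 isS1 isS2 : Step → Bool
isS0 s0 = true
isS0 _ = false
isS1 s1 = true
isS1 _ = false
isS2 s2 = true
isS2 _ = false

-- letter w_ℓ of w at the (1-based) label ℓ; default irrelevant
letter : List Step → ℕ → Step
letter (x ∷ xs) (suc zero) = x
letter (x ∷ xs) (suc (suc k)) = letter xs (suc k)
letter _ _ = s1

countS1 : List Step → ℕ
countS1 w = length (select isS1 w)

-- One step of the maximal tiling: in the current arrangement of strip labels
-- (whose letters form the current word) find the smallest position i with
-- w_i > w_{i+1}; report the tile (pair of strip labels) and swap.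
swapFirst' : (ℕ → Step) → ℕ → List ℕ → Maybe ((ℕ × ℕ) × List ℕ)
swapFirst' L a [] = nothing
swapFirst' L a (b ∷ xs) with rank (L b) <ᵇ rank (L a)
... | true = just ((a , b) , b ∷ a ∷ xs)
... | false with swapFirst' L b xs
...   | nothing = nothing
...   | just (p , ys) = just (p , a ∷ ys)

swapFirst : (ℕ → Step) → List ℕ → Maybe ((ℕ × ℕ) × List ℕ)
swapFirst L [] = nothing
swapFirst L (a ∷ xs) = swapFirst' L a xs

tilesF : (ℕ → Step) → ℕ → List ℕ → List (ℕ × ℕ)
tilesF L zero xs = []
tilesF L (suc f) xs with swapFirst L xs
... | nothing = []
... | just (p , ys) = p ∷ tilesF L f ys

-- All tiles of Γ_w, as cells (i , j) (i < j are the labels of the two strips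
-- through the tile), listed in the order they are added by the recursive
-- maximal tiling.  Each added tile lies on the southeast border of the
-- current region, so along any strip the tiles occur in this list in order
-- from the southeast border towards the northwest border (i.e. westwards
-- along a row, northwards along a column).  Fuel m*m exceeds the number of
-- inversions of w, hence the number of swaps.
tiles : List Step → List (ℕ × ℕ)
tiles w = tilesF (letter w) (length w * length w) (labels (length w))

InStrip : ℕ → ℕ × ℕ → Set
InStrip ℓ c = (ℓ ≡ proj₁ c) ⊎ (ℓ ≡ proj₂ c)

inStripB : ℕ → ℕ × ℕ → Bool
inStripB ℓ c = (ℓ ≡ᵇ proj₁ c) ∨ (ℓ ≡ᵇ proj₂ c)

Precedes : List (ℕ × ℕ) → ℕ × ℕ → ℕ × ℕ → Set
Precedes T c c' = ∃[ xs ] ∃[ ys ] ∃[ zs ] (T ≡ xs ++ (c ∷ ys ++ (c' ∷ zs)))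

data Arrow : Set where
  none up left : Arrow

isUp isLeft : Arrow → Bool
isUp up = true
isUp _ = false
isLeft left = true
isLeft _ = false

-- content of cell (i , j), i < j
Filling : Set
Filling = ℕ → ℕ → Arrow

at : Filling → ℕ × ℕ → Arrow
at F c = F (proj₁ c) (proj₂ c)

cellAt : Filling → ℕ → ℕ → Arrow
cellAt F a b = if a <ᵇ b then F a b else F b a

record IsRAT (w : List Step) (F : Filling) : Set where
  field
    emptyOff  : ∀ i j → ¬ ((i , j) ∈ tiles w) → F i j ≡ none
    upInCol   : ∀ i j → F i j ≡ up → (letter w i ≡ s0) ⊎ (letter w j ≡ s0)
    leftInRow : ∀ i j → F i j ≡ left → (letter w i ≡ s2) ⊎ (letter w j ≡ s2)
    -- an up-arrow points to the other cells of its column to its north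
    upAttack  : ∀ c c' κ → letter w κ ≡ s0 → InStrip κ c → InStrip κ c' →
                Precedes (tiles w) c c' → at F c ≡ up → at F c' ≡ none
    -- a left-arrow points to the other cells of its row to its west
    leftAttack : ∀ c c' ρ → letter w ρ ≡ s2 → InStrip ρ c → InStrip ρ c' →
                 Precedes (tiles w) c c' → at F c ≡ left → at F c' ≡ none

record RATplus (n r : ℕ) (w : List Step) (F : Filling) : Set where
  field
    len       : length w ≡ suc n
    diagCount : countS1 w ≡ suc r
    firstDiag : ∃[ w' ] (w ≡ s1 ∷ w')
    isRAT     : IsRAT w F
    colsUp    : ∀ κ → 1 ≤ κ → κ ≤ suc n → letter w κ ≡ s0 →
                ∃[ c ] ((c ∈ tiles w) × InStrip κ c × (at F c ≡ up))

data Sym : Set where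
  eps : ℕ → Sym
  lab : ℕ → Sym

eqSym : Sym → Sym → Bool
eqSym (eps a) (eps b) = a ≡ᵇ b
eqSym (lab a) (lab b) = a ≡ᵇ b
eqSym _ _ = false

diagonals : List Step → List ℕ
diagonals w = select (λ ℓ → isS1 (letter w ℓ)) (labels (length w))

epsIndex : List Step → ℕ → ℕ
epsIndex w ℓ = length (select (λ x → x ≤ᵇ ℓ) (diagonals w))

freeRows : List Step → Filling → List ℕ
freeRows w F = select (λ ρ → isS2 (letter w ρ) ∧
                  not (anyB (λ x → not (x ≡ᵇ ρ) ∧ isLeft (cellAt F ρ x)) (labels (length w))))
               (labels (length w))

insertBefore : Sym → List Sym → List Sym → List Sym
insertBefore t blk [] = blk
insertBefore t blk (x ∷ xs) = if eqSym x t then blk ++ (x ∷ xs) else x ∷ insertBefore t blk xs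

targetOf : List Step → Filling → ℕ → Sym
targetOf w F ℓ with letter w ℓ
... | s1 = eps (epsIndex w ℓ)
... | _ with firstB (λ x → not (x ≡ᵇ ℓ) ∧ isUp (cellAt F ℓ x)) (labels (length w))
...   | nothing = eps 0
...   | just h with letter w h
...     | s2 = lab h
...     | _  = eps (epsIndex w h)

leftPartners : List Step → Filling → ℕ → List ℕ
leftPartners w F ℓ = select (λ x → not (x ≡ᵇ ℓ) ∧ isLeft (cellAt F ℓ x)) (labels (length w))

insStep : List Step → Filling → List Sym → ℕ → List Sym
insStep w F v ℓ = insertBefore (targetOf w F ℓ) (map lab (leftPartners w F ℓ) ++ (lab ℓ ∷ [])) v

insertionWord : List Step → Filling → List Sym
insertionWord w F =
  foldl (insStep w F)
        (map eps (labels (length (diagonals w))) ++ map lab (freeRows w F))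
        (select (λ ℓ → not (isS2 (letter w ℓ))) (reverse (labels (length w))))

consHead : ℕ → List (List ℕ) → List (List ℕ)
consHead a [] = (a ∷ []) ∷ []
consHead a (b ∷ bs) = (a ∷ b) ∷ bs

blocks : List Sym → List (List ℕ)
blocks [] = [] ∷ []
blocks (eps _ ∷ xs) = [] ∷ blocks xs
blocks (lab a ∷ xs) = consHead a (blocks xs)

RLmax : List ℕ → ℕ
RLmax [] = 0
RLmax (x ∷ xs) = (if allB (λ y → y <ᵇ x) xs then 1 else 0) + RLmax xs

RLmin : List ℕ → ℕ
RLmin [] = 0
RLmin (x ∷ xs) = (if allB (λ y → x <ᵇ y) xs then 1 else 0) + RLmin xs

-- decomposition (X , Y , b_k) of B = b_1 ⋯ b_k : returns (X , Y).
-- X = b_1 ⋯ b_t with t the largest index < k such that b_t > b_k, Y the rest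
-- of b_1 ⋯ b_{k-1}; computed by stripping from the right the letters ≤ b_k.
decomp : List ℕ → List ℕ × List ℕ
decomp B with reverse B
... | [] = ([] , [])
... | b ∷ rinit = (reverse (dropWhileB (λ x → x ≤ᵇ b) rinit) ,
                   reverse (takeWhileB (λ x → x ≤ᵇ b) rinit))

upCount leftCount : List Step → Filling → ℕ → ℕ
upCount w F d = length (select (λ c → inStripB d c ∧ isUp (at F c)) (tiles w))
leftCount w F d = length (select (λ c → inStripB d c ∧ isLeft (at F c)) (tiles w))

-- Φ_I builds e(Φ_I(R)) by processing the column and diagonal strips in decreasing
-- order; strip ℓ inserts the word r₁⋯r_k ℓ, whose letters are at most ℓ.  Fix d = d_i
-- and follow the block B_i in front of ε_i.  Until d is processed, the words appended
-- to B_i come from the columns ℓ with their up-arrow in strip d; such an ℓ is smaller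
-- than the letter it follows (a strip processed earlier) and larger than the r's, so
-- it adds exactly one right-to-left maximum and removes none: RLmax B_i counts these
-- up-arrows.  Processing d appends its left partners in increasing order and then d,
-- which fixes X_i and makes Y_i the left partners, all of them right-to-left minima.
-- Every other insertion into B_i puts r₁⋯r_k ℓ in front of a row h carrying the
-- up-arrow of column ℓ.  The RAT conditions force every left-arrow of column ℓ into a
-- row ρ > h, so the inserted letters exceed h and stay below the last letter of the
-- block; hence RLmax X_i and RLmin Y_i do not change.

module Submission where

open import Defs
open import Data.Bool using (Bool; true; false; T; if_then_else_; not; _∧_)
open import Data.Bool.ListAction using (all)
open import Data.Bool.Properties using (T-≡; T-∧; T-∨; T-not-≡; ∧-assoc; ∧-comm; ∧-zeroʳ)
open import Data.Empty using (⊥-elim)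
open import Data.List using (List; []; _∷_; _++_; _∷ʳ_; [_]; head; length; map; reverse; foldl; filterᵇ; applyUpTo)
open import Data.List.Properties
  using (++-assoc; ++-identityʳ; ∷-injectiveˡ; ∷-injectiveʳ; length-map; map-++; reverse-++; reverse-involutive;
         reverse-applyUpTo; map-applyUpTo; length-applyUpTo)
open import Data.List.Reverse using (reverseView; []; _∶_∶ʳ_)
open import Data.List.Membership.Propositional using (_∈_; _∉_)
open import Data.List.Membership.Propositional.Properties
  using (∈-filter⁺; ∈-filter⁻; ∈-++⁺ˡ; ∈-++⁺ʳ; ∈-++⁻; ∈-∃++; ∈-map⁺; ∈-map⁻; ∈-applyUpTo⁺)
open import Data.List.Membership.Propositional.Properties.WithK using (unique∧set⇒bag)
open import Data.List.Relation.Binary.BagAndSetEquality using (∼bag⇒↭)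
open import Data.List.Relation.Binary.Permutation.Propositional using (_↭_; prep; swap; ↭-refl; ↭-sym)
open import Data.List.Relation.Binary.Permutation.Propositional.Properties
  using (All-resp-↭; ∈-resp-↭; ↭-reverse; ↭-length)
open import Data.List.Relation.Unary.Any using (here; there)
import Data.List.Relation.Unary.Any.Properties as Any
open import Data.List.Relation.Unary.All as All using (All; []; _∷_)
import Data.List.Relation.Unary.All.Properties as All
open import Data.List.Relation.Unary.AllPairs as AllPairs using (AllPairs; []; _∷_)
import Data.List.Relation.Unary.AllPairs.Properties as AllPairs
open import Data.List.Relation.Unary.Unique.Propositional using (Unique)
import Data.List.Relation.Unary.Unique.Propositional.Properties as Unique
open import Data.Maybe using (just; nothing)
import Data.Maybe.Relation.Unary.All as Maybe
open import Data.Nat using (ℕ; zero; suc; _+_; _*_; _≤_; _<_; _>_; _<ᵇ_; _≤ᵇ_; _≡ᵇ_; z≤n; s≤s; z<s; s<s)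
open import Data.Nat.Properties
  using (_≟_; +-assoc; +-comm; 0≢1+n; suc-injective; ≤-refl; ≤-reflexive; <-irrefl; <-asym; <-trans; <-cmp;
         <⇒≢; <⇒≤; <⇒≱; <ᵇ⇒<; <⇒<ᵇ; ≤ᵇ⇒≤; ≤⇒≤ᵇ; ≡ᵇ⇒≡; ≡⇒≡ᵇ)
open import Data.Product using (_×_; _,_; proj₁; proj₂; ∃-syntax)
import Data.Product as Product
open import Data.Product.Properties using (≡-dec; ,-injectiveˡ; ,-injectiveʳ)
open import Data.Sum using (_⊎_; inj₁; inj₂)
import Data.Sum as Sum
open import Function using (_∘_; flip; _⇔_; mk⇔; Equivalence)
open import Function.Definitions using (Injective)
open import Relation.Binary using (tri<; tri≈; tri>)
open import Relation.Binary.PropositionalEquality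
  using (_≡_; _≢_; refl; sym; trans; cong; cong₂; subst; module ≡-Reasoning)
open import Relation.Nullary using (¬_; T?; yes; no)
open import Data.List.Membership.DecPropositional _≟_ using (_∈?_)
import Data.List.Membership.DecPropositional
open ≡-Reasoning

module CellMembership = Data.List.Membership.DecPropositional (≡-dec _≟_ _≟_)

private variable
  E : Set
  a b x y z : E
  xs ys : List E

¬T⇒≡false : ∀ {b} → ¬ T b → b ≡ false
¬T⇒≡false {false} _ = refl
¬T⇒≡false {true} ¬t = ⊥-elim (¬t _)

∧-absorbs-implied : ∀ {a b} → (T b → T a) → a ∧ b ≡ b
∧-absorbs-implied {a} {false} _ = ∧-zeroʳ a
∧-absorbs-implied {true} {true} _ = refl
∧-absorbs-implied {false} {true} b⇒a = ⊥-elim (b⇒a _)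

select≡filterᵇ : ∀ (p : E → Bool) xs → select p xs ≡ filterᵇ p xs
select≡filterᵇ p [] = refl
select≡filterᵇ p (x ∷ xs) with p x
... | true = cong (x ∷_) (select≡filterᵇ p xs)
... | false = select≡filterᵇ p xs

∈-select⁻ : ∀ (p : E → Bool) → x ∈ select p xs → x ∈ xs × T (p x)
∈-select⁻ {xs = xs} p = ∈-filter⁻ (T? ∘ p) ∘ subst (_ ∈_) (select≡filterᵇ p xs)

∈-select⁺ : ∀ (p : E → Bool) → x ∈ xs → T (p x) → x ∈ select p xs
∈-select⁺ {xs = xs} p x∈ px = subst (_ ∈_) (sym (select≡filterᵇ p xs)) (∈-filter⁺ (T? ∘ p) x∈ px)

AllPairs-select : ∀ {R : E → E → Set} (p : E → Bool) → AllPairs R xs → AllPairs R (select p xs)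
AllPairs-select {xs = xs} p = subst (AllPairs _) (sym (select≡filterᵇ p xs)) ∘ AllPairs.filter⁺ (T? ∘ p)

select-accept : ∀ (p : E → Bool) x xs → T (p x) → select p (x ∷ xs) ≡ x ∷ select p xs
select-accept p x xs px with p x
... | true = refl

select-none : ∀ (p : E → Bool) {xs} → All (¬_ ∘ T ∘ p) xs → select p xs ≡ []
select-none p [] = refl
select-none p {x ∷ xs} (¬px ∷ ¬pxs) with p x
... | false = select-none p ¬pxs
... | true = ⊥-elim (¬px _)

length-select-∷ʳ-accept : ∀ (p : E → Bool) xs → T (p y) →
                          length (select p (xs ∷ʳ y)) ≡ suc (length (select p xs))
length-select-∷ʳ-accept {y = y} p [] py with p y
... | true = refl
length-select-∷ʳ-accept p (x ∷ xs) py with p x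
... | true = cong suc (length-select-∷ʳ-accept p xs py)
... | false = length-select-∷ʳ-accept p xs py

length-select-∷ʳ-reject : ∀ (p : E → Bool) xs → ¬ T (p y) →
                          length (select p (xs ∷ʳ y)) ≡ length (select p xs)
length-select-∷ʳ-reject {y = y} p [] ¬py with p y
... | false = refl
... | true = ⊥-elim (¬py _)
length-select-∷ʳ-reject p (x ∷ xs) ¬py with p x
... | true = cong suc (length-select-∷ʳ-reject p xs ¬py)
... | false = length-select-∷ʳ-reject p xs ¬py

length-select-∘ : ∀ {F : Set} (p : F → Bool) (f : E → F) xs →
                  length (select (p ∘ f) xs) ≡ length (select p (map f xs))
length-select-∘ p f [] = refl
length-select-∘ p f (x ∷ xs) with p (f x)
... | true = cong suc (length-select-∘ p f xs)
... | false = length-select-∘ p f xs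

allB≡all : ∀ (p : E → Bool) xs → allB p xs ≡ all p xs
allB≡all p [] = refl
allB≡all p (x ∷ xs) = cong (p x ∧_) (allB≡all p xs)

allB⁺ : ∀ (p : E → Bool) → All (T ∘ p) xs → T (allB p xs)
allB⁺ {xs = xs} p = subst T (sym (allB≡all p xs)) ∘ All.all⁻ p

allB⁻ : ∀ (p : E → Bool) → T (allB p xs) → All (T ∘ p) xs
allB⁻ {xs = xs} p = All.all⁺ p xs ∘ subst T (allB≡all p xs)

allB-reject : ∀ (p : E → Bool) → x ∈ xs → ¬ T (p x) → allB p xs ≡ false
allB-reject p x∈ ¬px = ¬T⇒≡false (λ t → ¬px (All.lookup (allB⁻ p t) x∈))

allB-++ : ∀ (p : E → Bool) xs ys → allB p (xs ++ ys) ≡ allB p xs ∧ allB p ys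
allB-++ p [] ys = refl
allB-++ p (x ∷ xs) ys = trans (cong (p x ∧_) (allB-++ p xs ys)) (sym (∧-assoc (p x) _ _))

takeWhileB-++ : ∀ (p : E → Bool) xs ys → All (T ∘ p) xs → Maybe.All (¬_ ∘ T ∘ p) (head ys) →
                takeWhileB p (xs ++ ys) ≡ xs
takeWhileB-++ p [] [] [] _ = refl
takeWhileB-++ p [] (y ∷ ys) [] (Maybe.just ¬py) with p y
... | false = refl
... | true = ⊥-elim (¬py _)
takeWhileB-++ p (x ∷ xs) ys (px ∷ pxs) ¬p-head with p x
... | true = cong (x ∷_) (takeWhileB-++ p xs ys pxs ¬p-head)

dropWhileB-++ : ∀ (p : E → Bool) xs ys → All (T ∘ p) xs → Maybe.All (¬_ ∘ T ∘ p) (head ys) →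
                dropWhileB p (xs ++ ys) ≡ ys
dropWhileB-++ p [] [] [] _ = refl
dropWhileB-++ p [] (y ∷ ys) [] (Maybe.just ¬py) with p y
... | false = refl
... | true = ⊥-elim (¬py _)
dropWhileB-++ p (x ∷ xs) ys (px ∷ pxs) ¬p-head with p x
... | true = dropWhileB-++ p xs ys pxs ¬p-head

firstB-just : ∀ p xs {h} → firstB p xs ≡ just h → h ∈ xs × T (p h)
firstB-just p (x ∷ xs) found with p x in px
firstB-just p (x ∷ xs) refl | true = here refl , Equivalence.from T-≡ px
... | false = Product.map₁ there (firstB-just p xs found)

firstB-nothing : ∀ p xs {x} → firstB p xs ≡ nothing → x ∈ xs → ¬ T (p x)
firstB-nothing p (y ∷ xs) not-found x∈ with p y in py
firstB-nothing p (y ∷ xs) () x∈ | true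
firstB-nothing p (y ∷ xs) not-found (here refl) | false = subst T py
firstB-nothing p (y ∷ xs) not-found (there x∈) | false = firstB-nothing p xs not-found x∈

lastL-∈ : lastL xs ≡ just x → x ∈ xs
lastL-∈ {xs = y ∷ []} refl = here refl
lastL-∈ {xs = y ∷ z ∷ xs} last≡x = there (lastL-∈ {xs = z ∷ xs} last≡x)

lastL-∷ : ∀ (x : E) xs → ∃[ y ] lastL (x ∷ xs) ≡ just y
lastL-∷ x [] = x , refl
lastL-∷ x (y ∷ xs) = lastL-∷ y xs

lastL-++-∷ : ∀ (xs : List E) y ys → lastL (xs ++ y ∷ ys) ≡ lastL (y ∷ ys)
lastL-++-∷ [] y ys = refl
lastL-++-∷ (x ∷ []) y ys = refl
lastL-++-∷ (x ∷ x′ ∷ xs) y ys = lastL-++-∷ (x′ ∷ xs) y ys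

lastL-∷ʳ : ∀ (xs : List E) y → lastL (xs ∷ʳ y) ≡ just y
lastL-∷ʳ xs y = lastL-++-∷ xs y []

head-reverse : ∀ (xs : List E) → head (reverse xs) ≡ lastL xs
head-reverse xs with reverseView xs
... | [] = refl
... | ys ∶ _ ∶ʳ y = trans (cong head (reverse-++ ys [ y ])) (sym (lastL-∷ʳ ys y))

nth-∈ : ∀ (xs : List E) {z i} → i < length xs → nth z xs (suc i) ∈ xs
nth-∈ (x ∷ xs) {i = zero} _ = here refl
nth-∈ (x ∷ xs) {i = suc i} (s≤s i<) = there (nth-∈ xs i<)

∈⇒nth : ∀ {xs : List E} {z h} → h ∈ xs → ∃[ i ] (i < length xs × nth z xs (suc i) ≡ h)
∈⇒nth (here refl) = 0 , z<s , refl
∈⇒nth {xs = _ ∷ xs} (there h∈) with i , i< , eq ← ∈⇒nth {xs = xs} h∈ = suc i , s<s i< , eq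

count≤-nth : ∀ {xs i} → AllPairs _<_ xs → i < length xs → length (select (_≤ᵇ nth 0 xs (suc i)) xs) ≡ suc i
count≤-nth {x ∷ xs} {zero} (x< ∷ _) _ = begin
  length (select (_≤ᵇ x) (x ∷ xs))
    ≡⟨ cong length (select-accept (_≤ᵇ x) x xs (≤⇒≤ᵇ (≤-refl {x}))) ⟩
  suc (length (select (_≤ᵇ x) xs))
    ≡⟨ cong (suc ∘ length) (select-none (_≤ᵇ x) (All.map (λ x<y → <⇒≱ x<y ∘ ≤ᵇ⇒≤ _ x) x<)) ⟩
  1 ∎
count≤-nth {x ∷ xs} {suc i} (x< ∷ sorted) (s≤s i<) = begin
  length (select (_≤ᵇ xᵢ) (x ∷ xs))
    ≡⟨ cong length (select-accept (_≤ᵇ xᵢ) x xs (≤⇒≤ᵇ (<⇒≤ (All.lookup x< (nth-∈ xs {0} i<))))) ⟩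
  suc (length (select (_≤ᵇ xᵢ) xs))
    ≡⟨ cong suc (count≤-nth sorted i<) ⟩
  suc (suc i) ∎
  where
  xᵢ : ℕ
  xᵢ = nth 0 xs (suc i)

nth-count≤ : ∀ {xs h} → AllPairs _<_ xs → h ∈ xs → nth 0 xs (length (select (_≤ᵇ h) xs)) ≡ h
nth-count≤ {xs} sorted h∈ with i , i< , refl ← ∈⇒nth {z = 0} h∈ = cong (nth 0 xs) (count≤-nth sorted i<)

∉-∷ʳ : x ∉ xs → y ≢ x → x ∉ xs ∷ʳ y
∉-∷ʳ {xs = xs} x∉ y≢x x∈ with ∈-++⁻ xs x∈
... | inj₁ x∈xs = x∉ x∈xs
... | inj₂ (here x≡y) = y≢x (sym x≡y)

unique∧set⇒length≡ : Unique xs → Unique ys → (∀ {z} → z ∈ xs ⇔ z ∈ ys) → length xs ≡ length ys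
unique∧set⇒length≡ u u′ same = ↭-length (∼bag⇒↭ (unique∧set⇒bag u u′ same))

foldl-invariant : ∀ {X : Set} (P : List E → X → Set) (f : X → E → X) xs x₀ →
  (∀ done y rest x → done ++ y ∷ rest ≡ xs → P done x → P (done ∷ʳ y) (f x y)) →
  P [] x₀ → P xs (foldl f x₀ xs)
foldl-invariant P f xs x₀ step P₀ = go [] xs x₀ refl P₀
  where
  go : ∀ done rest x → done ++ rest ≡ xs → P done x → P xs (foldl f x rest)
  go done [] x split Px = subst (λ ys → P ys x) (trans (sym (++-identityʳ done)) split) Px
  go done (y ∷ rest) x split Px =
    go (done ∷ʳ y) rest (f x y) (trans (++-assoc done [ y ] rest) split) (step done y rest x split Px)

data Before (x y : E) : List E → Set where
  here  : ∀ {zs} → y ∈ zs → Before x y (x ∷ zs)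
  there : ∀ {z zs} → Before x y zs → Before x y (z ∷ zs)

Before⇒∈ʳ : Before x y xs → y ∈ xs
Before⇒∈ʳ (here y∈) = there y∈
Before⇒∈ʳ (there b) = there (Before⇒∈ʳ b)

Before-asym : Unique xs → Before x y xs → ¬ Before y x xs
Before-asym (x∉ ∷ _) (here x∈) (here _) = All.lookup x∉ x∈ refl
Before-asym (x∉ ∷ _) (here _) (there yx) = All.lookup x∉ (Before⇒∈ʳ yx) refl
Before-asym (y∉ ∷ _) (there xy) (here _) = All.lookup y∉ (Before⇒∈ʳ xy) refl
Before-asym (_ ∷ u) (there xy) (there yx) = Before-asym u xy yx

Before-trans : Unique xs → Before x y xs → Before y z xs → Before x z xs
Before-trans (x∉ ∷ _) (here y∈) (here _) = ⊥-elim (All.lookup x∉ y∈ refl)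
Before-trans _ (here _) (there yz) = here (Before⇒∈ʳ yz)
Before-trans (y∉ ∷ _) (there xy) (here _) = ⊥-elim (All.lookup y∉ (Before⇒∈ʳ xy) refl)
Before-trans (_ ∷ u) (there xy) (there yz) = there (Before-trans u xy yz)

Before-AllPairs : ∀ {R : E → E → Set} → AllPairs R xs → Before x y xs → R x y
Before-AllPairs (Rx ∷ _) (here y∈) = All.lookup Rx y∈
Before-AllPairs (_ ∷ pairs) (there b) = Before-AllPairs pairs b

Before-++ : ∀ {ys} → x ∈ xs → Before x y (xs ++ y ∷ ys)
Before-++ {xs = _ ∷ xs} (here refl) = here (∈-++⁺ʳ xs (here refl))
Before-++ (there x∈) = there (Before-++ x∈)

Before-∷ : ∀ {c₀} → Before x y (c₀ ∷ xs) → (x ≡ c₀ × y ∈ xs) ⊎ Before x y xs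
Before-∷ (here y∈) = inj₁ (refl , y∈)
Before-∷ (there b) = inj₂ b

Before-total : x ∈ xs → y ∈ xs → x ≢ y → Before x y xs ⊎ Before y x xs
Before-total (here refl) (here refl) x≢y = ⊥-elim (x≢y refl)
Before-total (here refl) (there y∈) _ = inj₁ (here y∈)
Before-total (there x∈) (here refl) _ = inj₂ (here x∈)
Before-total (there x∈) (there y∈) x≢y = Sum.map there there (Before-total x∈ y∈ x≢y)

Before-applyUpTo : ∀ (f : ℕ → E) {i j n} → i < j → j < n → Before (f i) (f j) (applyUpTo f n)
Before-applyUpTo f {zero} {suc j} {suc n} _ (s<s j<n) = here (∈-applyUpTo⁺ (f ∘ suc) j<n)
Before-applyUpTo f {suc i} {suc j} {suc n} (s<s i<j) (s<s j<n) = there (Before-applyUpTo (f ∘ suc) i<j j<n)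

Precedes⇒Before : ∀ {T : List (ℕ × ℕ)} {c c′} → Precedes T c c′ → Before c c′ T
Precedes⇒Before ([] , ys , zs , refl) = here (∈-++⁺ʳ ys (here refl))
Precedes⇒Before (_ ∷ xs , ys , zs , refl) = there (Precedes⇒Before (xs , ys , zs , refl))

Before⇒Precedes : ∀ {T : List (ℕ × ℕ)} {c c′} → Before c c′ T → Precedes T c c′
Before⇒Precedes (here c′∈) with ys , zs , refl ← ∈-∃++ c′∈ = [] , ys , zs , refl
Before⇒Precedes (there b) with xs , ys , zs , refl ← Before⇒Precedes b = _ ∷ xs , ys , zs , refl

-- Right-to-left records and the decomposition of a block

indicator : Bool → ℕ
indicator b = if b then 1 else 0

module RightToLeftRecords
  (_≺_ : ℕ → ℕ → Bool)
  (≺-trans : ∀ {x y z} → T (x ≺ y) → T (y ≺ z) → T (x ≺ z))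
  (≺-asym : ∀ {x y} → T (x ≺ y) → ¬ T (y ≺ x))
  (records : List ℕ → ℕ)
  (records-[] : records [] ≡ 0)
  (records-∷ : ∀ x xs → records (x ∷ xs) ≡ indicator (allB (_≺ x) xs) + records xs)
  where

  records-∷-record : ∀ x xs → All (λ y → T (y ≺ x)) xs → records (x ∷ xs) ≡ suc (records xs)
  records-∷-record x xs xs≺x =
    trans (records-∷ x xs) (cong (λ b → indicator b + records xs) (Equivalence.to T-≡ (allB⁺ (_≺ x) xs≺x)))

  records-∷-dominated : ∀ x xs {c} → c ∈ xs → T (x ≺ c) → records (x ∷ xs) ≡ records xs
  records-∷-dominated x xs c∈ x≺c =
    trans (records-∷ x xs) (cong (λ b → indicator b + records xs) (allB-reject (_≺ x) c∈ (≺-asym x≺c)))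

  records-∷-cong : ∀ x xs ys → allB (_≺ x) xs ≡ allB (_≺ x) ys → records xs ≡ records ys →
                   records (x ∷ xs) ≡ records (x ∷ ys)
  records-∷-cong x xs ys eq₁ eq₂ =
    trans (records-∷ x xs) (trans (cong₂ (λ b r → indicator b + r) eq₁ eq₂) (sym (records-∷ x ys)))

  records-insert : ∀ A N {C c} → c ∈ C → All (λ y → T (y ≺ c)) N → records (A ++ N ++ C) ≡ records (A ++ C)
  records-insert [] [] c∈ N≺c = refl
  records-insert [] (y ∷ N) c∈ (y≺c ∷ N≺c) =
    trans (records-∷-dominated y (N ++ _) (∈-++⁺ʳ N c∈) y≺c) (records-insert [] N c∈ N≺c)
  records-insert (a ∷ A) N {C} c∈ N≺c = records-∷-cong a _ _ same-record (records-insert A N c∈ N≺c)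
    where
    C≺a⇒N≺a : T (allB (_≺ a) C) → T (allB (_≺ a) N)
    C≺a⇒N≺a C≺a = allB⁺ (_≺ a) (All.map (flip ≺-trans (All.lookup (allB⁻ (_≺ a) C≺a) c∈)) N≺c)

    same-record : allB (_≺ a) (A ++ N ++ C) ≡ allB (_≺ a) (A ++ C)
    same-record = begin
      allB (_≺ a) (A ++ N ++ C)                        ≡⟨ allB-++ (_≺ a) A (N ++ C) ⟩
      allB (_≺ a) A ∧ allB (_≺ a) (N ++ C)             ≡⟨ cong (allB (_≺ a) A ∧_) (allB-++ (_≺ a) N C) ⟩
      allB (_≺ a) A ∧ (allB (_≺ a) N ∧ allB (_≺ a) C)
        ≡⟨ cong (allB (_≺ a) A ∧_) (∧-absorbs-implied C≺a⇒N≺a) ⟩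
      allB (_≺ a) A ∧ allB (_≺ a) C                    ≡⟨ sym (allB-++ (_≺ a) A C) ⟩
      allB (_≺ a) (A ++ C)                             ∎

  records-singleton : ∀ x → records [ x ] ≡ 1
  records-singleton x = trans (records-∷-record x [] []) (cong suc records-[])

  records-++ : ∀ A {x C} → lastL A ≡ just x → All (λ y → T (y ≺ x)) C →
               records (A ++ C) ≡ records A + records C
  records-++ (a ∷ []) {C = C} refl C≺a =
    trans (records-∷-record a C C≺a) (cong (_+ records C) (sym (records-singleton a)))
  records-++ (a ∷ b ∷ A) {x} {C} last≡x C≺x = begin
    records (a ∷ b ∷ A ++ C)
      ≡⟨ records-∷ a _ ⟩
    indicator (allB (_≺ a) (b ∷ A ++ C)) + records (b ∷ A ++ C)
      ≡⟨ cong₂ (λ t r → indicator t + r) same-record (records-++ (b ∷ A) last≡x C≺x) ⟩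
    indicator (allB (_≺ a) (b ∷ A)) + (records (b ∷ A) + records C)
      ≡⟨ sym (+-assoc (indicator (allB (_≺ a) (b ∷ A))) (records (b ∷ A)) (records C)) ⟩
    indicator (allB (_≺ a) (b ∷ A)) + records (b ∷ A) + records C
      ≡⟨ cong (_+ records C) (sym (records-∷ a (b ∷ A))) ⟩
    records (a ∷ b ∷ A) + records C ∎
    where
    A≺a⇒C≺a : T (allB (_≺ a) (b ∷ A)) → T (allB (_≺ a) C)
    A≺a⇒C≺a A≺a =
      allB⁺ (_≺ a) (All.map (flip ≺-trans (All.lookup (allB⁻ (_≺ a) A≺a) (lastL-∈ {xs = b ∷ A} last≡x))) C≺x)

    same-record : allB (_≺ a) (b ∷ A ++ C) ≡ allB (_≺ a) (b ∷ A)
    same-record =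
      trans (allB-++ (_≺ a) (b ∷ A) C) (trans (∧-comm (allB (_≺ a) (b ∷ A)) _) (∧-absorbs-implied A≺a⇒C≺a))

  records-++-top : ∀ B {N ℓ} → Maybe.All (λ x → T (ℓ ≺ x)) (lastL B) → All (λ y → T (y ≺ ℓ)) N →
                   records (B ++ N ∷ʳ ℓ) ≡ suc (records B)
  records-++-top B {N} {ℓ} ℓ≺last N≺ℓ with reverseView B
  ... | [] = trans (records-insert [] N (here refl) N≺ℓ) (trans (records-singleton ℓ) (cong suc (sym records-[])))
  ... | B′ ∶ _ ∶ʳ x = begin
    records ((B′ ∷ʳ x) ++ N ∷ʳ ℓ)
      ≡⟨ records-++ (B′ ∷ʳ x) (lastL-∷ʳ B′ x) (All.++⁺ (All.map (flip ≺-trans ℓ≺x) N≺ℓ) (ℓ≺x ∷ [])) ⟩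
    records (B′ ∷ʳ x) + records (N ∷ʳ ℓ)
      ≡⟨ cong (records (B′ ∷ʳ x) +_) (trans (records-insert [] N (here refl) N≺ℓ) (records-singleton ℓ)) ⟩
    records (B′ ∷ʳ x) + 1
      ≡⟨ +-comm _ 1 ⟩
    suc (records (B′ ∷ʳ x)) ∎
    where
    ℓ≺x : T (ℓ ≺ x)
    ℓ≺x = Maybe.drop-just (subst (Maybe.All _) (lastL-∷ʳ B′ x) ℓ≺last)

  records-chain : ∀ {xs} → AllPairs (λ x y → T (y ≺ x)) xs → records xs ≡ length xs
  records-chain [] = records-[]
  records-chain {x ∷ xs} (xs≺x ∷ chain) = trans (records-∷-record x xs xs≺x) (cong suc (records-chain chain))

module RLmax = RightToLeftRecords _<ᵇ_
  (λ {x} {y} {z} x<y y<z → <⇒<ᵇ (<-trans (<ᵇ⇒< x y x<y) (<ᵇ⇒< y z y<z)))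
  (λ {x} {y} x<y y<x → <-asym (<ᵇ⇒< x y x<y) (<ᵇ⇒< y x y<x))
  RLmax refl (λ _ _ → refl)

module RLmin = RightToLeftRecords (flip _<ᵇ_)
  (λ {x} {y} {z} y<x z<y → <⇒<ᵇ (<-trans (<ᵇ⇒< z y z<y) (<ᵇ⇒< y x y<x)))
  (λ {x} {y} y<x x<y → <-asym (<ᵇ⇒< y x y<x) (<ᵇ⇒< x y x<y))
  RLmin refl (λ _ _ → refl)

decomp-reverse : ∀ B {b rs} → reverse B ≡ b ∷ rs →
                 decomp B ≡ (reverse (dropWhileB (_≤ᵇ b) rs) , reverse (takeWhileB (_≤ᵇ b) rs))
decomp-reverse B eq with reverse B
decomp-reverse B refl | _ = refl

decomp-split : ∀ X Y d → Maybe.All (d <_) (lastL X) → All (_< d) Y → decomp (X ++ Y ++ [ d ]) ≡ (X , Y)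
decomp-split X Y d d<last Y<d = begin
  decomp (X ++ Y ++ [ d ])
    ≡⟨ decomp-reverse (X ++ Y ++ [ d ]) reversed ⟩
  (reverse (dropWhileB (_≤ᵇ d) (reverse Y ++ reverse X)) , reverse (takeWhileB (_≤ᵇ d) (reverse Y ++ reverse X)))
    ≡⟨ cong₂ (λ X′ Y′ → reverse X′ , reverse Y′)
             (dropWhileB-++ (_≤ᵇ d) (reverse Y) (reverse X) Y≤d head>d)
             (takeWhileB-++ (_≤ᵇ d) (reverse Y) (reverse X) Y≤d head>d) ⟩
  (reverse (reverse X) , reverse (reverse Y))
    ≡⟨ cong₂ _,_ (reverse-involutive X) (reverse-involutive Y) ⟩
  (X , Y) ∎
  where
  reversed : reverse (X ++ Y ++ [ d ]) ≡ d ∷ reverse Y ++ reverse X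
  reversed = trans (reverse-++ X (Y ++ [ d ])) (cong (_++ reverse X) (reverse-++ Y [ d ]))

  Y≤d : All (T ∘ (_≤ᵇ d)) (reverse Y)
  Y≤d = All-resp-↭ (↭-sym (↭-reverse Y)) (All.map (≤⇒≤ᵇ ∘ <⇒≤) Y<d)

  head>d : Maybe.All (¬_ ∘ T ∘ (_≤ᵇ d)) (head (reverse X))
  head>d = subst (Maybe.All _) (sym (head-reverse X)) (Maybe.map (λ d<x → <⇒≱ d<x ∘ ≤ᵇ⇒≤ _ d) d<last)

insertLeftOf : ℕ → List ℕ → List ℕ → List ℕ
insertLeftOf h xs [] = xs
insertLeftOf h xs (y ∷ ys) with y ≟ h
... | yes _ = xs ++ y ∷ ys
... | no _ = y ∷ insertLeftOf h xs ys

insertLeftOf-head : ∀ h xs B → insertLeftOf h xs (h ∷ B) ≡ xs ++ h ∷ B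
insertLeftOf-head h xs B with h ≟ h
... | yes _ = refl
... | no h≢h = ⊥-elim (h≢h refl)

insertLeftOf-there : ∀ {h y} xs B → y ≢ h → insertLeftOf h xs (y ∷ B) ≡ y ∷ insertLeftOf h xs B
insertLeftOf-there {h} {y} xs B y≢h with y ≟ h
... | yes y≡h = ⊥-elim (y≢h y≡h)
... | no _ = refl

insertLeftOf-split : ∀ {h} N {B} → h ∈ B →
                     ∃[ A ] ∃[ C ] (B ≡ A ++ h ∷ C × insertLeftOf h N B ≡ A ++ N ++ h ∷ C)
insertLeftOf-split {h} N {y ∷ B} h∈ with y ≟ h | h∈
... | yes refl | _ = [] , B , refl , refl
... | no y≢h | here refl = ⊥-elim (y≢h refl)
... | no y≢h | there h∈B with A , C , B≡ , ins≡ ← insertLeftOf-split N h∈B =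
  y ∷ A , C , cong (y ∷_) B≡ , cong (y ∷_) ins≡

insertLeftOf-++ˡ : ∀ {h} N {X} Z → h ∈ X → insertLeftOf h N (X ++ Z) ≡ insertLeftOf h N X ++ Z
insertLeftOf-++ˡ {h} N {y ∷ X} Z h∈ with y ≟ h | h∈
... | yes _ | _ = sym (++-assoc N (y ∷ X) Z)
... | no y≢h | here refl = ⊥-elim (y≢h refl)
... | no y≢h | there h∈X = cong (y ∷_) (insertLeftOf-++ˡ N Z h∈X)

insertLeftOf-++ʳ : ∀ {h} N X Z → h ∉ X → insertLeftOf h N (X ++ Z) ≡ X ++ insertLeftOf h N Z
insertLeftOf-++ʳ N [] Z h∉ = refl
insertLeftOf-++ʳ {h} N (y ∷ X) Z h∉ with y ≟ h
... | yes refl = ⊥-elim (h∉ (here refl))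
... | no _ = cong (y ∷_) (insertLeftOf-++ʳ N X Z (h∉ ∘ there))

All-insertLeftOf : ∀ {P : ℕ → Set} {h N B} → All P N → All P B → All P (insertLeftOf h N B)
All-insertLeftOf PN [] = PN
All-insertLeftOf {h = h} {B = y ∷ B} PN (Py ∷ PB) with y ≟ h
... | yes _ = All.++⁺ PN (Py ∷ PB)
... | no _ = Py ∷ All-insertLeftOf PN PB

lastL-insertLeftOf : ∀ {h} N {B} → h ∈ B → lastL (insertLeftOf h N B) ≡ lastL B
lastL-insertLeftOf {h} N h∈ with A , C , refl , inserted ← insertLeftOf-split N h∈ = begin
  lastL (insertLeftOf h N (A ++ h ∷ C)) ≡⟨ cong lastL inserted ⟩
  lastL (A ++ N ++ h ∷ C)               ≡⟨ cong lastL (sym (++-assoc A N (h ∷ C))) ⟩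
  lastL ((A ++ N) ++ h ∷ C)             ≡⟨ lastL-++-∷ (A ++ N) h C ⟩
  lastL (h ∷ C)                         ≡⟨ sym (lastL-++-∷ A h C) ⟩
  lastL (A ++ h ∷ C)                    ∎

RLmax-insertLeftOf : ∀ {h} N {B} → h ∈ B → Maybe.All (λ x → All (_< x) N) (lastL B) →
                     RLmax (insertLeftOf h N B) ≡ RLmax B
RLmax-insertLeftOf {h} N h∈ N<last
  with A , C , refl , inserted ← insertLeftOf-split N h∈
  with y , last≡y ← lastL-∷ h C =
  trans (cong RLmax inserted)
        (RLmax.records-insert A N (lastL-∈ last≡y)
          (All.map <⇒<ᵇ (Maybe.drop-just (subst (Maybe.All _) (trans (lastL-++-∷ A h C) last≡y) N<last))))

RLmin-insertLeftOf : ∀ {h} N {B} → h ∈ B → All (h <_) N → RLmin (insertLeftOf h N B) ≡ RLmin B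
RLmin-insertLeftOf {h} N h∈ h<N with A , C , refl , inserted ← insertLeftOf-split N h∈ =
  trans (cong RLmin inserted) (RLmin.records-insert A N (here refl) (All.map <⇒<ᵇ h<N))

-- Blocks of ε-words

εLabels : List Sym → List ℕ
εLabels [] = []
εLabels (eps k ∷ v) = k ∷ εLabels v
εLabels (lab a ∷ v) = εLabels v

block : ℕ → List Sym → List ℕ
block i v = nth [] (blocks v) i

block₁-lab : ∀ a v → block 1 (lab a ∷ v) ≡ a ∷ block 1 v
block₁-lab a v with blocks v
... | [] = refl
... | _ ∷ _ = refl

block₂₊-lab : ∀ a v i → block (suc (suc i)) (lab a ∷ v) ≡ block (suc (suc i)) v
block₂₊-lab a v i with blocks v
... | [] = refl
... | _ ∷ _ = refl

block-lab-append : ∀ a i v v′ ys → block (suc i) v′ ≡ block (suc i) v ++ ys →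
                   block (suc i) (lab a ∷ v′) ≡ block (suc i) (lab a ∷ v) ++ ys
block-lab-append a zero v v′ ys eq =
  trans (block₁-lab a v′) (trans (cong (a ∷_) eq) (cong (_++ ys) (sym (block₁-lab a v))))
block-lab-append a (suc i) v v′ ys eq =
  trans (block₂₊-lab a v′ i) (trans eq (cong (_++ ys) (sym (block₂₊-lab a v i))))

block-lab-same : ∀ a i v v′ → block (suc i) v′ ≡ block (suc i) v →
                 block (suc i) (lab a ∷ v′) ≡ block (suc i) (lab a ∷ v)
block-lab-same a zero v v′ eq = trans (block₁-lab a v′) (trans (cong (a ∷_) eq) (sym (block₁-lab a v)))
block-lab-same a (suc i) v v′ eq = trans (block₂₊-lab a v′ i) (trans eq (sym (block₂₊-lab a v i)))

block₁-map-lab : ∀ xs v → block 1 (map lab xs ++ v) ≡ xs ++ block 1 v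
block₁-map-lab [] v = refl
block₁-map-lab (x ∷ xs) v = trans (block₁-lab x (map lab xs ++ v)) (cong (x ∷_) (block₁-map-lab xs v))

block₂₊-map-lab : ∀ xs v i → block (suc (suc i)) (map lab xs ++ v) ≡ block (suc (suc i)) v
block₂₊-map-lab [] v i = refl
block₂₊-map-lab (x ∷ xs) v i = trans (block₂₊-lab x (map lab xs ++ v) i) (block₂₊-map-lab xs v i)

block-map-ε : ∀ ks v i → i < length ks → block (suc i) (map eps ks ++ v) ≡ []
block-map-ε (k ∷ ks) v zero _ = refl
block-map-ε (k ∷ ks) v (suc i) (s≤s i<) = block-map-ε ks v i i<

εLabels-map-lab : ∀ xs v → εLabels (map lab xs ++ v) ≡ εLabels v
εLabels-map-lab [] v = refl
εLabels-map-lab (x ∷ xs) v = εLabels-map-lab xs v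

εLabels-map-ε : ∀ ks xs → εLabels (map eps ks ++ map lab xs) ≡ ks
εLabels-map-ε [] xs = trans (cong εLabels (sym (++-identityʳ (map lab xs)))) (εLabels-map-lab xs [])
εLabels-map-ε (k ∷ ks) xs = cong (k ∷_) (εLabels-map-ε ks xs)

eps-injective : ∀ {a b} → eps a ≡ eps b → a ≡ b
eps-injective refl = refl

lab-injective : ∀ {a b} → lab a ≡ lab b → a ≡ b
lab-injective refl = refl

eqSym-refl : ∀ s → T (eqSym s s)
eqSym-refl (eps k) = ≡⇒≡ᵇ k k refl
eqSym-refl (lab a) = ≡⇒≡ᵇ a a refl

eqSym-sound : ∀ s t → T (eqSym s t) → s ≡ t
eqSym-sound (eps a) (eps b) eq = cong eps (≡ᵇ⇒≡ a b eq)
eqSym-sound (lab a) (lab b) eq = cong lab (≡ᵇ⇒≡ a b eq)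

insertBefore-here : ∀ t blk v → insertBefore t blk (t ∷ v) ≡ blk ++ t ∷ v
insertBefore-here t blk v with eqSym t t | eqSym-refl t
... | true | _ = refl

insertBefore-there : ∀ {s t} blk v → s ≢ t → insertBefore t blk (s ∷ v) ≡ s ∷ insertBefore t blk v
insertBefore-there {s} {t} blk v s≢t with eqSym s t | eqSym-sound s t
... | false | _ = refl
... | true | sound = ⊥-elim (s≢t (sound _))

εLabels-insertBefore : ∀ t xs v → εLabels (insertBefore t (map lab xs) v) ≡ εLabels v
εLabels-insertBefore t xs [] = trans (cong εLabels (sym (++-identityʳ (map lab xs)))) (εLabels-map-lab xs [])
εLabels-insertBefore t xs (s ∷ v) with eqSym s t
... | true = εLabels-map-lab xs (s ∷ v)
εLabels-insertBefore t xs (eps k ∷ v) | false = cong (k ∷_) (εLabels-insertBefore t xs v)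
εLabels-insertBefore t xs (lab a ∷ v) | false = εLabels-insertBefore t xs v

block-insertBefore-closingε : ∀ {f} → Injective _≡_ _≡_ f → ∀ v {c} i xs → εLabels v ≡ applyUpTo f c →
                              i < c → block (suc i) (insertBefore (eps (f i)) (map lab xs) v) ≡ block (suc i) v ++ xs
block-insertBefore-closingε f-inj [] {suc c} i xs () i<c
block-insertBefore-closingε {f} f-inj (lab a ∷ v) i xs labels i<c =
  block-lab-append a i v (insertBefore (eps (f i)) (map lab xs) v) xs (block-insertBefore-closingε f-inj v i xs labels i<c)
block-insertBefore-closingε {f} f-inj (eps k ∷ v) {suc c} zero xs labels _
  with refl ← ∷-injectiveˡ labels = begin
  block 1 (insertBefore (eps (f 0)) (map lab xs) (eps (f 0) ∷ v))
    ≡⟨ cong (block 1) (insertBefore-here (eps (f 0)) (map lab xs) v) ⟩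
  block 1 (map lab xs ++ eps (f 0) ∷ v)
    ≡⟨ block₁-map-lab xs (eps (f 0) ∷ v) ⟩
  xs ++ []
    ≡⟨ ++-identityʳ xs ⟩
  xs ∎
block-insertBefore-closingε {f} f-inj (eps k ∷ v) {suc c} (suc i) xs labels (s≤s i<c) = begin
  block (2 + i) (insertBefore (eps (f (suc i))) (map lab xs) (eps k ∷ v))
    ≡⟨ cong (block (2 + i)) (insertBefore-there (map lab xs) v k≢fi) ⟩
  block (suc i) (insertBefore (eps (f (suc i))) (map lab xs) v)
    ≡⟨ block-insertBefore-closingε (suc-injective ∘ f-inj) v i xs (∷-injectiveʳ labels) i<c ⟩
  block (suc i) v ++ xs ∎
  where
  k≢fi : eps k ≢ eps (f (suc i))
  k≢fi eq = 0≢1+n (f-inj (trans (sym (∷-injectiveˡ labels)) (eps-injective eq)))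

block-insertBefore-otherε : ∀ {f} v {c} i j xs → εLabels v ≡ applyUpTo f c → i < c → j ≢ f i →
  block (suc i) (insertBefore (eps j) (map lab xs) v) ≡ block (suc i) v
block-insertBefore-otherε [] {suc c} i j xs () i<c j≢fi
block-insertBefore-otherε (lab a ∷ v) i j xs labels i<c j≢fi =
  block-lab-same a i v (insertBefore (eps j) (map lab xs) v) (block-insertBefore-otherε v i j xs labels i<c j≢fi)
block-insertBefore-otherε (eps k ∷ v) {suc c} zero j xs labels _ j≢f0 =
  cong (block 1)
       (insertBefore-there (map lab xs) v (λ k≡j → j≢f0 (trans (sym (eps-injective k≡j)) (∷-injectiveˡ labels))))
block-insertBefore-otherε (eps k ∷ v) {suc c} (suc i) j xs labels (s≤s i<c) j≢fi with k ≟ j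
... | yes refl = trans (cong (block (2 + i)) (insertBefore-here (eps k) (map lab xs) v))
                       (block₂₊-map-lab xs (eps k ∷ v) i)
... | no k≢j = trans (cong (block (2 + i)) (insertBefore-there (map lab xs) v (k≢j ∘ eps-injective)))
                     (block-insertBefore-otherε v i j xs (∷-injectiveʳ labels) i<c j≢fi)

-- The bound on i excludes the final block, to which insertBefore appends when h is absent.
block-insertBefore-lab : ∀ v i h xs → i < length (εLabels v) →
  let v′ = insertBefore (lab h) (map lab xs) v in
  block (suc i) v′ ≡ block (suc i) v
  ⊎ (h ∈ block (suc i) v × block (suc i) v′ ≡ insertLeftOf h xs (block (suc i) v))
block-insertBefore-lab (eps k ∷ v) zero h xs _ = inj₁ refl
block-insertBefore-lab (eps k ∷ v) (suc i) h xs (s≤s i<) = block-insertBefore-lab v i h xs i<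
block-insertBefore-lab (lab a ∷ v) i h xs i< with a ≟ h
block-insertBefore-lab (lab a ∷ v) zero h xs i< | yes refl
  rewrite insertBefore-here (lab a) (map lab xs) v | block₁-map-lab xs (lab a ∷ v) | block₁-lab a v =
  inj₂ (here refl , sym (insertLeftOf-head a xs (block 1 v)))
block-insertBefore-lab (lab a ∷ v) (suc i) h xs i< | yes refl =
  inj₁ (trans (cong (block (2 + i)) (insertBefore-here (lab a) (map lab xs) v)) (block₂₊-map-lab xs (lab a ∷ v) i))
block-insertBefore-lab (lab a ∷ v) zero h xs i< | no a≢h
  rewrite insertBefore-there (map lab xs) v (a≢h ∘ lab-injective)
        | block₁-lab a (insertBefore (lab h) (map lab xs) v) | block₁-lab a v | insertLeftOf-there xs (block 1 v) a≢h
  with block-insertBefore-lab v zero h xs i<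
... | inj₁ same = inj₁ (cong (a ∷_) same)
... | inj₂ (h∈ , inserted) = inj₂ (there h∈ , cong (a ∷_) inserted)
block-insertBefore-lab (lab a ∷ v) (suc i) h xs i< | no a≢h
  rewrite insertBefore-there (map lab xs) v (a≢h ∘ lab-injective)
        | block₂₊-lab a (insertBefore (lab h) (map lab xs) v) i | block₂₊-lab a v i =
  block-insertBefore-lab v (suc i) h xs i<

-- The maximal tiling

labels-increasing : ∀ m → AllPairs _<_ (labels m)
labels-increasing m = AllPairs.applyUpTo⁺₁ suc m (λ i<j _ → s<s i<j)

∈-labels : ∀ {m x} → 0 < x → x ≤ m → x ∈ labels m
∈-labels {x = suc x} _ x≤m = ∈-applyUpTo⁺ suc x≤m

T-isS1 : ∀ {s} → T (isS1 s) → s ≡ s1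
T-isS1 {s1} _ = refl

applyUpTo-letter : ∀ w → applyUpTo (letter w ∘ suc) (length w) ≡ w
applyUpTo-letter [] = refl
applyUpTo-letter (s ∷ w) = cong (s ∷_) (applyUpTo-letter w)

length-diagonals : ∀ w → length (diagonals w) ≡ countS1 w
length-diagonals w = begin
  length (select (isS1 ∘ letter w) (labels (length w)))
    ≡⟨ length-select-∘ isS1 (letter w) (labels (length w)) ⟩
  length (select isS1 (map (letter w) (labels (length w))))
    ≡⟨ cong (length ∘ select isS1) (map-applyUpTo suc (letter w) (length w)) ⟩
  length (select isS1 (applyUpTo (letter w ∘ suc) (length w)))
    ≡⟨ cong (length ∘ select isS1) (applyUpTo-letter w) ⟩
  countS1 w ∎

letter-in-range : ∀ w x → letter w x ≢ s1 → 0 < x × x ≤ length w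
letter-in-range (_ ∷ _) (suc zero) _ = z<s , s≤s z≤n
letter-in-range (_ ∷ w) (suc (suc x)) not-s1 = z<s , s≤s (proj₂ (letter-in-range w (suc x) not-s1))
letter-in-range [] zero not-s1 = ⊥-elim (not-s1 refl)
letter-in-range [] (suc x) not-s1 = ⊥-elim (not-s1 refl)
letter-in-range (_ ∷ _) zero not-s1 = ⊥-elim (not-s1 refl)

rank-s0-least : ∀ {s s′} → s′ ≡ s0 → ¬ rank s < rank s′
rank-s0-least refl ()

rank-s2-greatest : ∀ {s s′} → s ≡ s2 → ¬ rank s < rank s′
rank-s2-greatest {s′ = s0} refl ()
rank-s2-greatest {s′ = s1} refl (s≤s ())
rank-s2-greatest {s′ = s2} refl (s≤s (s≤s ()))

data AdjacentSwap (a b : E) : List E → List E → Set where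
  swap-here  : ∀ zs → AdjacentSwap a b (a ∷ b ∷ zs) (b ∷ a ∷ zs)
  swap-there : ∀ z {xs ys} → AdjacentSwap a b xs ys → AdjacentSwap a b (z ∷ xs) (z ∷ ys)

AdjacentSwap-sym : AdjacentSwap a b xs ys → AdjacentSwap b a ys xs
AdjacentSwap-sym (swap-here zs) = swap-here zs
AdjacentSwap-sym (swap-there z s) = swap-there z (AdjacentSwap-sym s)

AdjacentSwap⇒↭ : AdjacentSwap a b xs ys → xs ↭ ys
AdjacentSwap⇒↭ (swap-here zs) = swap _ _ ↭-refl
AdjacentSwap⇒↭ (swap-there z s) = prep z (AdjacentSwap⇒↭ s)

AdjacentSwap-Unique : AdjacentSwap a b xs ys → Unique xs → Unique ys
AdjacentSwap-Unique (swap-here zs) ((a≢b ∷ a∉) ∷ b∉ ∷ u) = (a≢b ∘ sym ∷ b∉) ∷ a∉ ∷ u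
AdjacentSwap-Unique (swap-there z s) (z∉ ∷ u) = All-resp-↭ (AdjacentSwap⇒↭ s) z∉ ∷ AdjacentSwap-Unique s u

AdjacentSwap-Beforeˡ : AdjacentSwap a b xs ys → Before a b xs
AdjacentSwap-Beforeˡ (swap-here zs) = here (here refl)
AdjacentSwap-Beforeˡ (swap-there z s) = there (AdjacentSwap-Beforeˡ s)

AdjacentSwap-Before : AdjacentSwap a b xs ys → Before x y xs → Before x y ys ⊎ (x ≡ a × y ≡ b)
AdjacentSwap-Before (swap-here zs) (here (here y≡b)) = inj₂ (refl , y≡b)
AdjacentSwap-Before (swap-here zs) (here (there y∈)) = inj₁ (there (here y∈))
AdjacentSwap-Before (swap-here zs) (there (here y∈)) = inj₁ (here (there y∈))
AdjacentSwap-Before (swap-here zs) (there (there xy)) = inj₁ (there (there xy))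
AdjacentSwap-Before (swap-there z s) (here y∈) = inj₁ (here (∈-resp-↭ (AdjacentSwap⇒↭ s) y∈))
AdjacentSwap-Before (swap-there z s) (there xy) = Sum.map₁ there (AdjacentSwap-Before s xy)

module Tiling (L : ℕ → Step) where

  rk : ℕ → ℕ
  rk = rank ∘ L

  InversionsRankIncreasing : List ℕ → Set
  InversionsRankIncreasing xs = ∀ {x y} → Before x y xs → y < x → rk x < rk y

  swapFirst′-swaps : ∀ a xs {p q ys} → swapFirst' L a xs ≡ just ((p , q) , ys) →
                     rk q < rk p × AdjacentSwap p q (a ∷ xs) ys
  swapFirst′-swaps a (b ∷ xs) found with rank (L b) <ᵇ rank (L a) in descent
  swapFirst′-swaps a (b ∷ xs) refl | true = <ᵇ⇒< _ _ (Equivalence.from T-≡ descent) , swap-here xs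
  ... | false with swapFirst' L b xs in found′
  swapFirst′-swaps a (b ∷ xs) refl | false | just _ = Product.map₂ (swap-there a) (swapFirst′-swaps b xs found′)

  swapFirst-swaps : ∀ xs {p q ys} → swapFirst L xs ≡ just ((p , q) , ys) → rk q < rk p × AdjacentSwap p q xs ys
  swapFirst-swaps (a ∷ xs) = swapFirst′-swaps a xs

  swap-keeps-Before : ∀ {a b x y xs ys} → rk b < rk a → AdjacentSwap a b xs ys →
                      Before x y xs → rk x ≤ rk y → Before x y ys
  swap-keeps-Before descent s xy rx≤ry with AdjacentSwap-Before s xy
  ... | inj₁ xy′ = xy′
  ... | inj₂ (refl , refl) = ⊥-elim (<⇒≱ descent rx≤ry)

  swap-keeps-InversionsRankIncreasing : ∀ {a b xs ys} → rk b < rk a → AdjacentSwap a b xs ys →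
    InversionsRankIncreasing xs → InversionsRankIncreasing ys
  swap-keeps-InversionsRankIncreasing descent s inv xy y<x with AdjacentSwap-Before (AdjacentSwap-sym s) xy
  ... | inj₁ xy′ = inv xy′ y<x
  ... | inj₂ (refl , refl) = descent

  tilesF-ordered : ∀ f xs → InversionsRankIncreasing xs → ∀ {c} → c ∈ tilesF L f xs →
                   proj₁ c < proj₂ c × rk (proj₂ c) < rk (proj₁ c)
  tilesF-ordered (suc f) xs inv c∈ with swapFirst L xs in found
  tilesF-ordered (suc f) xs inv (here refl) | just ((a , b) , ys)
    with descent , s ← swapFirst-swaps xs found with <-cmp a b
  ... | tri< a<b _ _ = a<b , descent
  ... | tri≈ _ refl _ = ⊥-elim (<-irrefl refl descent)
  ... | tri> _ _ b<a = ⊥-elim (<-asym descent (inv (AdjacentSwap-Beforeˡ s) b<a))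
  tilesF-ordered (suc f) xs inv (there c∈) | just ((a , b) , ys) with descent , s ← swapFirst-swaps xs found =
    tilesF-ordered f ys (swap-keeps-InversionsRankIncreasing descent s inv) c∈

  tilesF-never-reversed : ∀ f xs {x y} → Unique xs → Before x y xs → rk x ≤ rk y → (y , x) ∉ tilesF L f xs
  tilesF-never-reversed (suc f) xs u xy rx≤ry yx∈ with swapFirst L xs in found
  tilesF-never-reversed (suc f) xs u xy rx≤ry (here refl) | just (_ , ys) with _ , s ← swapFirst-swaps xs found =
    Before-asym u xy (AdjacentSwap-Beforeˡ s)
  tilesF-never-reversed (suc f) xs u xy rx≤ry (there yx∈) | just (_ , ys) with descent , s ← swapFirst-swaps xs found =
    tilesF-never-reversed f ys (AdjacentSwap-Unique s u) (swap-keeps-Before descent s xy rx≤ry) rx≤ry yx∈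

  -- After a swap, b stands before a with smaller rank, so the two are never swapped back.
  tilesF-unique : ∀ f xs → Unique xs → Unique (tilesF L f xs)
  tilesF-unique zero xs u = []
  tilesF-unique (suc f) xs u with swapFirst L xs in found
  ... | nothing = []
  ... | just ((a , b) , ys) with descent , s ← swapFirst-swaps xs found =
    All.tabulate (λ c∈ ab≡c → not-again (subst (_∈ _) (sym ab≡c) c∈)) ∷ tilesF-unique f ys u′
    where
    u′ : Unique ys
    u′ = AdjacentSwap-Unique s u
    not-again : (a , b) ∉ tilesF L f ys
    not-again = tilesF-never-reversed f ys u′ (AdjacentSwap-Beforeˡ (AdjacentSwap-sym s)) (<⇒≤ descent)

  -- Producing (ρ′ , ℓ) puts ℓ before ρ′, hence before ρ for good, so (ρ , ℓ) never follows.
  tilesF-parallel-reversed : ∀ f xs {ρ′ ρ ℓ} → Unique xs → rk ρ′ ≡ rk ρ → Before ρ′ ρ xs →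
                             ¬ Before (ρ′ , ℓ) (ρ , ℓ) (tilesF L f xs)
  tilesF-parallel-reversed (suc f) xs u same-rk ρ′ρ tiles-order with swapFirst L xs in found
  ... | just (_ , ys) with descent , s ← swapFirst-swaps xs found with Before-∷ tiles-order
  ... | inj₂ tiles-order′ = tilesF-parallel-reversed f ys u′ same-rk ρ′ρ′ tiles-order′
    where
    u′ : Unique ys
    u′ = AdjacentSwap-Unique s u
    ρ′ρ′ : Before _ _ ys
    ρ′ρ′ = swap-keeps-Before descent s ρ′ρ (≤-reflexive same-rk)
  ... | inj₁ (refl , ρℓ∈) =
    tilesF-never-reversed f ys u′ (Before-trans u′ (AdjacentSwap-Beforeˡ (AdjacentSwap-sym s)) ρ′ρ′)
      (<⇒≤ (subst (rk _ <_) same-rk descent)) ρℓ∈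
    where
    u′ : Unique ys
    u′ = AdjacentSwap-Unique s u
    ρ′ρ′ : Before _ _ ys
    ρ′ρ′ = swap-keeps-Before descent s ρ′ρ (≤-reflexive same-rk)

module _ (w : List Step) where
  open Tiling (letter w)

  private
    m : ℕ
    m = length w

  tile-ordered : ∀ {c} → c ∈ tiles w → proj₁ c < proj₂ c × rank (letter w (proj₂ c)) < rank (letter w (proj₁ c))
  tile-ordered =
    tilesF-ordered (m * m) (labels m) (λ xy y<x → ⊥-elim (<-asym y<x (Before-AllPairs (labels-increasing m) xy)))

  tiles-unique : Unique (tiles w)
  tiles-unique = tilesF-unique (m * m) (labels m) (AllPairs.map <⇒≢ (labels-increasing m))

  tiles-parallel-reversed : ∀ {ρ′ ρ ℓ} → 0 < ρ′ → ρ′ < ρ → ρ ≤ length w → letter w ρ′ ≡ letter w ρ →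
                            ¬ Precedes (tiles w) (ρ′ , ℓ) (ρ , ℓ)
  tiles-parallel-reversed {suc i} {suc j} _ (s<s i<j) j<m same-letter =
    tilesF-parallel-reversed (m * m) (labels m) (AllPairs.map <⇒≢ (labels-increasing m)) (cong rank same-letter)
      (Before-applyUpTo suc i<j j<m) ∘ Precedes⇒Before

-- Rhombic alternative tableaux

T-isUp : ∀ {α} → T (isUp α) → α ≡ up
T-isUp {up} _ = refl

T-isLeft : ∀ {α} → T (isLeft α) → α ≡ left
T-isLeft {left} _ = refl

isUp-≢ : ∀ {α} → α ≢ up → ¬ T (isUp α)
isUp-≢ α≢up = α≢up ∘ T-isUp

T-inStripB : ∀ d c → T (inStripB d c) → InStrip d c
T-inStripB d (a , b) t with Equivalence.to T-∨ t
... | inj₁ d≡a = inj₁ (≡ᵇ⇒≡ d a d≡a)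
... | inj₂ d≡b = inj₂ (≡ᵇ⇒≡ d b d≡b)

≢⇒T-not-≡ᵇ : ∀ {x y} → x ≢ y → T (not (x ≡ᵇ y))
≢⇒T-not-≡ᵇ {x} {y} x≢y = Equivalence.from T-not-≡ (¬T⇒≡false (x≢y ∘ ≡ᵇ⇒≡ x y))

up≢none : up ≢ none
up≢none ()

up≢left : up ≢ left
up≢left ()

left≢none : left ≢ none
left≢none ()

cellAt-< : ∀ F {ℓ x} → x < ℓ → cellAt F ℓ x ≡ F x ℓ
cellAt-< F {ℓ} {x} x<ℓ with ℓ <ᵇ x | <ᵇ⇒< ℓ x
... | false | _ = refl
... | true | ℓ<x = ⊥-elim (<-asym x<ℓ (ℓ<x _))

module RAT {w : List Step} {F : Filling} (rat : IsRAT w F) where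
  open IsRAT rat

  L : ℕ → Step
  L = letter w

  filled⇒tile : ∀ {a b α} → F a b ≡ α → α ≢ none → (a , b) ∈ tiles w
  filled⇒tile {a} {b} refl filled with CellMembership._∈?_ (a , b) (tiles w)
  ... | yes ab∈ = ab∈
  ... | no ab∉ = ⊥-elim (filled (emptyOff a b ab∉))

  up⇒column : ∀ {a b} → F a b ≡ up → a < b × L b ≡ s0 × L a ≢ s0
  up⇒column {a} {b} up-ab with tile-ordered w (filled⇒tile up-ab λ ()) | upInCol a b up-ab
  ... | a<b , rb<ra | inj₂ Lb≡s0 = a<b , Lb≡s0 , λ La≡s0 → rank-s0-least La≡s0 rb<ra
  ... | _   , rb<ra | inj₁ La≡s0 = ⊥-elim (rank-s0-least La≡s0 rb<ra)

  left⇒row : ∀ {a b} → F a b ≡ left → a < b × L a ≡ s2 × L b ≢ s2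
  left⇒row {a} {b} left-ab with tile-ordered w (filled⇒tile left-ab λ ()) | leftInRow a b left-ab
  ... | a<b , rb<ra | inj₁ La≡s2 = a<b , La≡s2 , λ Lb≡s2 → rank-s2-greatest Lb≡s2 rb<ra
  ... | _   , rb<ra | inj₂ Lb≡s2 = ⊥-elim (rank-s2-greatest Lb≡s2 rb<ra)

  noncolumn⇒no-up : ∀ {ℓ x} → L ℓ ≢ s0 → F x ℓ ≢ up
  noncolumn⇒no-up ℓ-not-column = ℓ-not-column ∘ proj₁ ∘ proj₂ ∘ up⇒column

  up-attacks : ∀ {a b κ} → F a κ ≡ up → Before (a , κ) (b , κ) (tiles w) → F b κ ≡ none
  up-attacks {a} {b} {κ} up-aκ order =
    upAttack (a , κ) (b , κ) κ (proj₁ (proj₂ (up⇒column up-aκ))) (inj₂ refl) (inj₂ refl)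
             (Before⇒Precedes order) up-aκ

  up-unique : ∀ {a b κ} → F a κ ≡ up → F b κ ≡ up → a ≡ b
  up-unique {a} {b} up-a up-b with a ≟ b
  ... | yes a≡b = a≡b
  ... | no a≢b with Before-total (filled⇒tile up-a λ ()) (filled⇒tile up-b λ ()) (a≢b ∘ ,-injectiveˡ)
  ... | inj₁ order = ⊥-elim (up≢none (trans (sym up-b) (up-attacks up-a order)))
  ... | inj₂ order = ⊥-elim (up≢none (trans (sym up-a) (up-attacks up-b order)))

  letter≢ : ∀ {x s s′} → L x ≡ s → s ≢ s′ → L x ≢ s′
  letter≢ Lx≡s s≢s′ Lx≡s′ = s≢s′ (trans (sym Lx≡s) Lx≡s′)

  up-above-left : ∀ {h ρ ℓ} → L h ≡ s2 → F h ℓ ≡ up → F ρ ℓ ≡ left → h < ρ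
  up-above-left {h} {ρ} {ℓ} Lh≡s2 up-hℓ left-ρℓ with <-cmp h ρ
  ... | tri< h<ρ _ _ = h<ρ
  ... | tri≈ _ refl _ = ⊥-elim (up≢left (trans (sym up-hℓ) left-ρℓ))
  ... | tri> _ _ ρ<h
    with Before-total (filled⇒tile up-hℓ λ ()) (filled⇒tile left-ρℓ λ ()) (λ eq → <-irrefl (sym (,-injectiveˡ eq)) ρ<h)
  ... | inj₁ order = ⊥-elim (left≢none (trans (sym left-ρℓ) (up-attacks up-hℓ order)))
  ... | inj₂ order =
    ⊥-elim (tiles-parallel-reversed w 0<ρ ρ<h (proj₂ (letter-in-range w h (letter≢ Lh≡s2 λ ())))
                                    (trans Lρ≡s2 (sym Lh≡s2)) (Before⇒Precedes order))
    where
    Lρ≡s2 : L ρ ≡ s2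
    Lρ≡s2 = proj₁ (proj₂ (left⇒row left-ρℓ))
    0<ρ : 0 < ρ
    0<ρ = proj₁ (letter-in-range w ρ (letter≢ Lρ≡s2 λ ()))

  up-in-column : ∀ {ℓ x} → L ℓ ≡ s0 → cellAt F ℓ x ≡ up → x < ℓ × F x ℓ ≡ up
  up-in-column {ℓ} {x} Lℓ≡s0 up-cell with ℓ <ᵇ x
  ... | true = ⊥-elim (proj₂ (proj₂ (up⇒column up-cell)) Lℓ≡s0)
  ... | false = proj₁ (up⇒column up-cell) , up-cell

  left-in-nonrow : ∀ {ℓ x} → L ℓ ≢ s2 → cellAt F ℓ x ≡ left → x < ℓ × F x ℓ ≡ left
  left-in-nonrow {ℓ} {x} ℓ-not-row left-cell with ℓ <ᵇ x
  ... | true = ⊥-elim (ℓ-not-row (proj₁ (proj₂ (left⇒row left-cell))))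
  ... | false = proj₁ (left⇒row left-cell) , left-cell

  leftPartner⇒left : ∀ {ℓ x} → L ℓ ≢ s2 → x ∈ leftPartners w F ℓ → x < ℓ × F x ℓ ≡ left
  leftPartner⇒left ℓ-not-row x∈ =
    left-in-nonrow ℓ-not-row (T-isLeft (proj₂ (Equivalence.to T-∧ (proj₂ (∈-select⁻ {xs = labels (length w)} _ x∈)))))

  leftPartners-increasing : ∀ ℓ → AllPairs _<_ (leftPartners w F ℓ)
  leftPartners-increasing ℓ = AllPairs-select {xs = labels (length w)} _ (labels-increasing (length w))

  upCount-diagonal : ∀ {d S} → L d ≡ s1 → Unique S → (∀ {ℓ} → L ℓ ≡ s0 → ℓ ∈ S) →
                     upCount w F d ≡ length (select (isUp ∘ F d) S)
  upCount-diagonal {d} {S} Ld≡s1 S-unique columns∈S = begin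
    upCount w F d
      ≡⟨ unique∧set⇒length≡ (AllPairs-select {xs = tiles w} P (tiles-unique w))
                             (Unique.map⁺ ,-injectiveʳ (AllPairs-select {xs = S} (isUp ∘ F d) S-unique)) (mk⇔ to from) ⟩
    length (map (d ,_) (select (isUp ∘ F d) S))
      ≡⟨ length-map (d ,_) (select (isUp ∘ F d) S) ⟩
    length (select (isUp ∘ F d) S) ∎
    where
    P : ℕ × ℕ → Bool
    P c = inStripB d c ∧ isUp (at F c)

    to : ∀ {c} → c ∈ select P (tiles w) → c ∈ map (d ,_) (select (isUp ∘ F d) S)
    to {a , b} c∈ with Equivalence.to T-∧ (proj₂ (∈-select⁻ {xs = tiles w} P c∈))
    ... | in-strip , is-up with up⇒column (T-isUp is-up) | T-inStripB d (a , b) in-strip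
    ... | _ , Lb≡s0 , _ | inj₁ refl = ∈-map⁺ (d ,_) (∈-select⁺ (isUp ∘ F d) (columns∈S Lb≡s0) is-up)
    ... | _ , Lb≡s0 , _ | inj₂ refl = ⊥-elim (letter≢ Ld≡s1 (λ ()) Lb≡s0)

    from : ∀ {c} → c ∈ map (d ,_) (select (isUp ∘ F d) S) → c ∈ select P (tiles w)
    from c∈ with ℓ , ℓ∈ , refl ← ∈-map⁻ (d ,_) c∈
            with is-up ← proj₂ (∈-select⁻ {xs = S} (isUp ∘ F d) ℓ∈) =
      ∈-select⁺ P (filled⇒tile (T-isUp is-up) λ ())
        (Equivalence.from T-∧ (Equivalence.from T-∨ (inj₁ (≡⇒≡ᵇ d d refl)) , is-up))

  leftCount-nonrow : ∀ {d} → L d ≢ s2 → leftCount w F d ≡ length (leftPartners w F d)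
  leftCount-nonrow {d} d-not-row = begin
    leftCount w F d
      ≡⟨ unique∧set⇒length≡ (AllPairs-select {xs = tiles w} P (tiles-unique w))
                             (Unique.map⁺ ,-injectiveˡ (AllPairs.map <⇒≢ (leftPartners-increasing d))) (mk⇔ to from) ⟩
    length (map (_, d) (leftPartners w F d))
      ≡⟨ length-map (_, d) (leftPartners w F d) ⟩
    length (leftPartners w F d) ∎
    where
    P : ℕ × ℕ → Bool
    P c = inStripB d c ∧ isLeft (at F c)

    to : ∀ {c} → c ∈ select P (tiles w) → c ∈ map (_, d) (leftPartners w F d)
    to {a , b} c∈ with Equivalence.to T-∧ (proj₂ (∈-select⁻ {xs = tiles w} P c∈))
    ... | in-strip , is-left with left⇒row (T-isLeft is-left) | T-inStripB d (a , b) in-strip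
    ... | _ , La≡s2 , _ | inj₁ refl = ⊥-elim (d-not-row La≡s2)
    ... | a<d , La≡s2 , _ | inj₂ refl =
      ∈-map⁺ (_, d) (∈-select⁺ _ (∈-labels 0<a a≤m)
        (Equivalence.from T-∧ (≢⇒T-not-≡ᵇ (<⇒≢ a<d) , subst (T ∘ isLeft) (sym (cellAt-< F a<d)) is-left)))
      where
      0<a : 0 < a
      0<a = proj₁ (letter-in-range w a (letter≢ La≡s2 λ ()))
      a≤m : a ≤ length w
      a≤m = proj₂ (letter-in-range w a (letter≢ La≡s2 λ ()))

    from : ∀ {c} → c ∈ map (_, d) (leftPartners w F d) → c ∈ select P (tiles w)
    from c∈ with x , x∈ , refl ← ∈-map⁻ (_, d) c∈ with _ , left-xd ← leftPartner⇒left d-not-row x∈ =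
      ∈-select⁺ P (filled⇒tile left-xd λ ())
        (Equivalence.from T-∧ (Equivalence.from T-∨ (inj₂ (≡⇒≡ᵇ d d refl)) , subst (T ∘ isLeft) (sym left-xd) _))

  -- The search predicate of targetOf, named so that `with` can abstract over it.
  upward : ℕ → ℕ → Bool
  upward ℓ x = not (x ≡ᵇ ℓ) ∧ isUp (cellAt F ℓ x)

  upward⇒up : ∀ {ℓ x} → L ℓ ≡ s0 → T (upward ℓ x) → F x ℓ ≡ up
  upward⇒up Lℓ≡s0 t = proj₂ (up-in-column Lℓ≡s0 (T-isUp (proj₂ (Equivalence.to T-∧ t))))

  -- ε₀ is the junk target of a column without up-arrow; it never occurs in the word.
  data Target (ℓ : ℕ) : Sym → Set where
    diagonal              : L ℓ ≡ s1 → Target ℓ (eps (epsIndex w ℓ))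
    empty-column          : L ℓ ≡ s0 → (∀ {x} → x ∈ labels (length w) → F x ℓ ≢ up) → Target ℓ (eps 0)
    column-up-to-row      : ∀ {h} → L ℓ ≡ s0 → L h ≡ s2 → F h ℓ ≡ up → Target ℓ (lab h)
    column-up-to-diagonal : ∀ {h} → L ℓ ≡ s0 → L h ≡ s1 → h ∈ labels (length w) → F h ℓ ≡ up →
                            Target ℓ (eps (epsIndex w h))

  target : ∀ ℓ → L ℓ ≢ s2 → Target ℓ (targetOf w F ℓ)
  target ℓ ℓ-not-row with L ℓ in Lℓ
  ... | s1 = diagonal Lℓ
  ... | s2 = ⊥-elim (ℓ-not-row refl)
  ... | s0 with firstB (upward ℓ) (labels (length w)) in found
  ...   | nothing = empty-column Lℓ no-up
    where
    no-up : ∀ {x} → x ∈ labels (length w) → F x ℓ ≢ up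
    no-up x∈ up-xℓ = firstB-nothing (upward ℓ) (labels (length w)) found x∈
      (Equivalence.from T-∧ (≢⇒T-not-≡ᵇ (<⇒≢ x<ℓ) , subst (T ∘ isUp) (sym (trans (cellAt-< F x<ℓ) up-xℓ)) _))
      where
      x<ℓ : _ < ℓ
      x<ℓ = proj₁ (up⇒column up-xℓ)
  ...   | just h with L h in Lh | firstB-just (upward ℓ) (labels (length w)) found
  ...     | s2 | _ , upward-h = column-up-to-row Lℓ Lh (upward⇒up Lℓ upward-h)
  ...     | s1 | h∈ , upward-h = column-up-to-diagonal Lℓ Lh h∈ (upward⇒up Lℓ upward-h)
  ...     | s0 | _ , upward-h = ⊥-elim (proj₂ (proj₂ (up⇒column (upward⇒up Lℓ upward-h))) Lh)

-- The block of a diagonal strip under insertion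

module DiagonalBlock {w : List Step} {F : Filling} (rat : IsRAT w F) {i′ : ℕ} (i′<r : i′ < length (diagonals w))
  where
  open RAT rat

  m r i d : ℕ
  m = length w
  r = length (diagonals w)
  i = suc i′
  d = nth 0 (diagonals w) i

  diagonals-increasing : AllPairs _<_ (diagonals w)
  diagonals-increasing = AllPairs-select {xs = labels m} _ (labels-increasing m)

  d∈labels : d ∈ labels m
  d∈labels = proj₁ (∈-select⁻ {xs = labels m} _ (nth-∈ (diagonals w) i′<r))

  Ld≡s1 : L d ≡ s1
  Ld≡s1 = T-isS1 (proj₂ (∈-select⁻ {xs = labels m} _ (nth-∈ (diagonals w) i′<r)))

  d-not-row : L d ≢ s2
  d-not-row = letter≢ Ld≡s1 λ ()

  epsIndex-d : epsIndex w d ≡ i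
  epsIndex-d = count≤-nth diagonals-increasing i′<r

  epsIndex≡i⇒d : ∀ {h} → L h ≡ s1 → h ∈ labels m → epsIndex w h ≡ i → h ≡ d
  epsIndex≡i⇒d Lh≡s1 h∈ index≡i =
    trans (sym (nth-count≤ diagonals-increasing (∈-select⁺ (isS1 ∘ L) h∈ (subst (T ∘ isS1) (sym Lh≡s1) _))))
          (cong (nth 0 (diagonals w)) index≡i)

  i′<#labels : i′ < length (labels r)
  i′<#labels = subst (i′ <_) (sym (length-applyUpTo suc r)) i′<r

  column≢d : ∀ {ℓ} → L ℓ ≡ s0 → ℓ ≢ d
  column≢d Lℓ≡s0 ℓ≡d = letter≢ Lℓ≡s0 (λ ()) (trans (cong L ℓ≡d) Ld≡s1)

  column-not-row : ∀ {h ℓ} → F h ℓ ≡ up → L ℓ ≢ s2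
  column-not-row up-hℓ = letter≢ (proj₁ (proj₂ (up⇒column up-hℓ))) λ ()

  row-up⇒no-up-at-d : ∀ {h ℓ} → L h ≡ s2 → F h ℓ ≡ up → F d ℓ ≢ up
  row-up⇒no-up-at-d Lh≡s2 up-hℓ up-dℓ = d-not-row (subst (λ x → L x ≡ s2) (up-unique up-hℓ up-dℓ) Lh≡s2)

  upsIn : List ℕ → ℕ
  upsIn S = length (select (isUp ∘ F d) S)

  upsIn-∷ʳ-up : ∀ {ℓ} S → F d ℓ ≡ up → upsIn (S ∷ʳ ℓ) ≡ suc (upsIn S)
  upsIn-∷ʳ-up S up-dℓ = length-select-∷ʳ-accept (isUp ∘ F d) S (subst (T ∘ isUp) (sym up-dℓ) _)

  upsIn-∷ʳ-no-up : ∀ {ℓ} S → F d ℓ ≢ up → upsIn (S ∷ʳ ℓ) ≡ upsIn S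
  upsIn-∷ʳ-no-up S no-up = length-select-∷ʳ-reject (isUp ∘ F d) S (isUp-≢ no-up)

  segment : ℕ → List ℕ
  segment ℓ = leftPartners w F ℓ ∷ʳ ℓ

  segment-below : ∀ {ℓ x} → L ℓ ≢ s2 → ℓ < x → All (_< x) (segment ℓ)
  segment-below ℓ-not-row ℓ<x =
    All.++⁺ (All.tabulate (λ ρ∈ → <-trans (proj₁ (leftPartner⇒left ℓ-not-row ρ∈)) ℓ<x)) (ℓ<x ∷ [])

  segment-above-up : ∀ {h ℓ} → L h ≡ s2 → F h ℓ ≡ up → All (h <_) (segment ℓ)
  segment-above-up Lh≡s2 up-hℓ =
    All.++⁺ (All.tabulate (λ ρ∈ → up-above-left Lh≡s2 up-hℓ (proj₂ (leftPartner⇒left (column-not-row up-hℓ) ρ∈))))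
            (proj₁ (up⇒column up-hℓ) ∷ [])

  lastL-segment : ∀ B ℓ → lastL (B ++ segment ℓ) ≡ just ℓ
  lastL-segment B ℓ =
    trans (cong lastL (sym (++-assoc B (leftPartners w F ℓ) [ ℓ ]))) (lastL-∷ʳ (B ++ leftPartners w F ℓ) ℓ)

  data Stage (done B : List ℕ) : Set where
    pending : d ∉ done → RLmax B ≡ upsIn done → Maybe.All (λ x → d < x × x ∈ done) (lastL B) → Stage done B
    placed  : ∀ X Y → d ∈ done → B ≡ X ++ Y ++ [ d ] → Maybe.All (d <_) (lastL X) → All (_< d) Y →
              RLmax X ≡ upsIn done → RLmin Y ≡ length (leftPartners w F d) → Stage done B

  Stage-skip : ∀ {done ℓ B} → ℓ ≢ d → F d ℓ ≢ up → Stage done B → Stage (done ∷ʳ ℓ) B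
  Stage-skip {done} ℓ≢d no-up (pending d∉ ups last) =
    pending (∉-∷ʳ d∉ ℓ≢d) (trans ups (sym (upsIn-∷ʳ-no-up done no-up))) (Maybe.map (Product.map₂ ∈-++⁺ˡ) last)
  Stage-skip {done} ℓ≢d no-up (placed X Y d∈ B≡ last Y<d ups lefts) =
    placed X Y (∈-++⁺ˡ d∈) B≡ last Y<d (trans ups (sym (upsIn-∷ʳ-no-up done no-up))) lefts

  Stage-place-d : ∀ {done B} → All (d <_) done → Stage done B → Stage (done ∷ʳ d) (B ++ segment d)
  Stage-place-d {done} {B} d<done (pending d∉ ups last) =
    placed B (leftPartners w F d) (∈-++⁺ʳ done (here refl)) refl (Maybe.map proj₁ last)
      (All.tabulate (proj₁ ∘ leftPartner⇒left d-not-row))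
      (trans ups (sym (upsIn-∷ʳ-no-up done (noncolumn⇒no-up (letter≢ Ld≡s1 λ ())))))
      (RLmin.records-chain (AllPairs.map <⇒<ᵇ (leftPartners-increasing d)))
  Stage-place-d d<done (placed _ _ d∈ _ _ _ _ _) = ⊥-elim (<-irrefl refl (All.lookup d<done d∈))

  Stage-column-to-d : ∀ {done ℓ B} → All (ℓ <_) done → F d ℓ ≡ up → Stage done B →
                      Stage (done ∷ʳ ℓ) (B ++ segment ℓ)
  Stage-column-to-d {done} {ℓ} {B} ℓ<done up-dℓ (pending d∉ ups last) =
    pending (∉-∷ʳ d∉ (λ ℓ≡d → <-irrefl (sym ℓ≡d) d<ℓ)) ups′
            (subst (Maybe.All _) (sym (lastL-segment B ℓ)) (Maybe.just (d<ℓ , ∈-++⁺ʳ done (here refl))))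
    where
    d<ℓ : d < ℓ
    d<ℓ = proj₁ (up⇒column up-dℓ)

    ups′ : RLmax (B ++ segment ℓ) ≡ upsIn (done ∷ʳ ℓ)
    ups′ = begin
      RLmax (B ++ segment ℓ)
        ≡⟨ RLmax.records-++-top B (Maybe.map (<⇒<ᵇ ∘ All.lookup ℓ<done ∘ proj₂) last)
                                  (All.tabulate (<⇒<ᵇ ∘ proj₁ ∘ leftPartner⇒left (column-not-row up-dℓ))) ⟩
      suc (RLmax B)     ≡⟨ cong suc ups ⟩
      suc (upsIn done)  ≡⟨ sym (upsIn-∷ʳ-up done up-dℓ) ⟩
      upsIn (done ∷ʳ ℓ) ∎
  Stage-column-to-d ℓ<done up-dℓ (placed _ _ d∈ _ _ _ _ _) =
    ⊥-elim (<-asym (All.lookup ℓ<done d∈) (proj₁ (up⇒column up-dℓ)))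

  Stage-column-to-row : ∀ {done ℓ h B} → All (ℓ <_) done → L h ≡ s2 → F h ℓ ≡ up → h ∈ B →
                        Stage done B → Stage done (insertLeftOf h (segment ℓ) B)
  Stage-column-to-row {ℓ = ℓ} ℓ<done _ up-hℓ h∈ (pending d∉ ups last) =
    pending d∉
      (trans (RLmax-insertLeftOf (segment ℓ) h∈
                (Maybe.map (segment-below (column-not-row up-hℓ) ∘ All.lookup ℓ<done ∘ proj₂) last))
             ups)
      (subst (Maybe.All _) (sym (lastL-insertLeftOf (segment ℓ) h∈)) last)
  Stage-column-to-row {ℓ = ℓ} {h} ℓ<done Lh≡s2 up-hℓ h∈ (placed X Y d∈ refl lastX Y<d ups lefts) with h ∈? X
  ... | yes h∈X =
    placed (insertLeftOf h (segment ℓ) X) Y d∈ (insertLeftOf-++ˡ (segment ℓ) (Y ++ [ d ]) h∈X)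
      (subst (Maybe.All _) (sym (lastL-insertLeftOf (segment ℓ) h∈X)) lastX) Y<d
      (trans (RLmax-insertLeftOf (segment ℓ) h∈X
                (Maybe.map (segment-below (column-not-row up-hℓ) ∘ <-trans (All.lookup ℓ<done d∈)) lastX))
             ups)
      lefts
  ... | no h∉X =
    placed X (insertLeftOf h (segment ℓ) Y) d∈
      (trans (insertLeftOf-++ʳ (segment ℓ) X (Y ++ [ d ]) h∉X) (cong (X ++_) (insertLeftOf-++ˡ (segment ℓ) [ d ] h∈Y)))
      lastX (All-insertLeftOf (segment-below (column-not-row up-hℓ) (All.lookup ℓ<done d∈)) Y<d) ups
      (trans (RLmin-insertLeftOf (segment ℓ) h∈Y (segment-above-up Lh≡s2 up-hℓ)) lefts)
    where
    h∈Y : h ∈ Y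
    h∈Y with ∈-++⁻ X h∈
    ... | inj₁ h∈X = ⊥-elim (h∉X h∈X)
    ... | inj₂ h∈Yd with ∈-++⁻ Y h∈Yd
    ...   | inj₁ h∈Y = h∈Y
    ...   | inj₂ (here refl) = ⊥-elim (d-not-row Lh≡s2)

  insStep-segment : ∀ v ℓ → insStep w F v ℓ ≡ insertBefore (targetOf w F ℓ) (map lab (segment ℓ)) v
  insStep-segment v ℓ =
    cong (λ blk → insertBefore (targetOf w F ℓ) blk v) (sym (map-++ lab (leftPartners w F ℓ) [ ℓ ]))

  Stage-step : ∀ {done ℓ} v → All (ℓ <_) done → L ℓ ≢ s2 → ℓ ∈ labels m → εLabels v ≡ labels r →
               Stage done (block i v) →
               Stage (done ∷ʳ ℓ) (block i (insertBefore (targetOf w F ℓ) (map lab (segment ℓ)) v))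
  Stage-step {ℓ = ℓ} v ℓ<done ℓ-not-row ℓ∈ εs stage with targetOf w F ℓ | target ℓ ℓ-not-row
  ... | _ | diagonal Lℓ≡s1 with ℓ ≟ d
  ...   | yes refl rewrite epsIndex-d =
    subst (Stage _) (sym (block-insertBefore-closingε suc-injective v i′ (segment d) εs i′<r))
      (Stage-place-d ℓ<done stage)
  ...   | no ℓ≢d =
    subst (Stage _) (sym (block-insertBefore-otherε v i′ _ (segment ℓ) εs i′<r (ℓ≢d ∘ epsIndex≡i⇒d Lℓ≡s1 ℓ∈)))
      (Stage-skip ℓ≢d (noncolumn⇒no-up (letter≢ Lℓ≡s1 λ ())) stage)
  Stage-step {ℓ = ℓ} v ℓ<done ℓ-not-row ℓ∈ εs stage | _ | empty-column Lℓ≡s0 no-up =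
    subst (Stage _) (sym (block-insertBefore-otherε v i′ 0 (segment ℓ) εs i′<r λ ()))
      (Stage-skip (column≢d Lℓ≡s0) (no-up d∈labels) stage)
  Stage-step {ℓ = ℓ} v ℓ<done ℓ-not-row ℓ∈ εs stage | _ | column-up-to-row {h} Lℓ≡s0 Lh≡s2 up-hℓ
    with block-insertBefore-lab v i′ h (segment ℓ) (subst (i′ <_) (cong length (sym εs)) i′<#labels)
  ... | inj₁ same =
    subst (Stage _) (sym same) (Stage-skip (column≢d Lℓ≡s0) (row-up⇒no-up-at-d Lh≡s2 up-hℓ) stage)
  ... | inj₂ (h∈ , inserted) =
    subst (Stage _) (sym inserted)
      (Stage-skip (column≢d Lℓ≡s0) (row-up⇒no-up-at-d Lh≡s2 up-hℓ)
                  (Stage-column-to-row ℓ<done Lh≡s2 up-hℓ h∈ stage))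
  Stage-step {ℓ = ℓ} v ℓ<done ℓ-not-row ℓ∈ εs stage | _ | column-up-to-diagonal {h} Lℓ≡s0 Lh≡s1 h∈ up-hℓ
    with epsIndex w h ≟ i
  ... | yes index≡i with refl ← epsIndex≡i⇒d Lh≡s1 h∈ index≡i rewrite epsIndex-d =
    subst (Stage _) (sym (block-insertBefore-closingε suc-injective v i′ (segment ℓ) εs i′<r))
      (Stage-column-to-d ℓ<done up-hℓ stage)
  ... | no index≢i =
    subst (Stage _) (sym (block-insertBefore-otherε v i′ _ (segment ℓ) εs i′<r index≢i))
      (Stage-skip (column≢d Lℓ≡s0)
                  (λ up-dℓ → index≢i (trans (cong (epsIndex w) (up-unique up-hℓ up-dℓ)) epsIndex-d)) stage)

  strips : List ℕ
  strips = select (λ ℓ → not (isS2 (L ℓ))) (reverse (labels m))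

  strips-decreasing : AllPairs _>_ strips
  strips-decreasing = AllPairs-select {xs = reverse (labels m)} _
    (subst (AllPairs _>_) (sym (reverse-applyUpTo suc m)) (AllPairs.applyDownFrom⁺₁ suc m (λ j<i _ → s<s j<i)))

  ∈-strips⁻ : ∀ {ℓ} → ℓ ∈ strips → ℓ ∈ labels m × L ℓ ≢ s2
  ∈-strips⁻ ℓ∈ with ℓ∈rev , not-row ← ∈-select⁻ {xs = reverse (labels m)} _ ℓ∈ =
    Any.reverse⁻ ℓ∈rev , λ Lℓ≡s2 → subst (T ∘ not ∘ isS2) Lℓ≡s2 not-row

  ∈-strips⁺ : ∀ {ℓ} → ℓ ∈ labels m → L ℓ ≢ s2 → ℓ ∈ strips
  ∈-strips⁺ {ℓ} ℓ∈ ℓ-not-row =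
    ∈-select⁺ (λ ℓ → not (isS2 (L ℓ))) (Any.reverse⁺ ℓ∈) (not-s2 (L ℓ) ℓ-not-row)
    where
    not-s2 : ∀ s → s ≢ s2 → T (not (isS2 s))
    not-s2 s0 _ = _
    not-s2 s1 _ = _
    not-s2 s2 s≢s2 = s≢s2 refl

  Invariant : List ℕ → List Sym → Set
  Invariant done v = εLabels v ≡ labels r × Stage done (block i v)

  invariant-initial : Invariant [] (map eps (labels r) ++ map lab (freeRows w F))
  invariant-initial =
    εLabels-map-ε (labels r) (freeRows w F) ,
    subst (Stage []) (sym (block-map-ε (labels r) _ i′ i′<#labels)) (pending (λ ()) refl Maybe.nothing)

  invariant-step : ∀ done ℓ rest v → done ++ ℓ ∷ rest ≡ strips →
                   Invariant done v → Invariant (done ∷ʳ ℓ) (insStep w F v ℓ)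
  invariant-step done ℓ rest v split (εs , stage) rewrite insStep-segment v ℓ =
    trans (εLabels-insertBefore (targetOf w F ℓ) (segment ℓ) v) εs ,
    Stage-step v ℓ<done (proj₂ (∈-strips⁻ ℓ∈)) (proj₁ (∈-strips⁻ ℓ∈)) εs stage
    where
    ℓ∈ : ℓ ∈ strips
    ℓ∈ = subst (ℓ ∈_) split (∈-++⁺ʳ done (here refl))

    ℓ<done : All (ℓ <_) done
    ℓ<done = All.tabulate (Before-AllPairs (subst (AllPairs _>_) (sym split) strips-decreasing) ∘ Before-++)

  final-stage : Stage strips (block i (insertionWord w F))
  final-stage = proj₂ (foldl-invariant Invariant (insStep w F) strips _ invariant-step invariant-initial)

  diagonal-block-statistics :
    let B = block i (insertionWord w F) in
    lastL B ≡ just d × upCount w F d ≡ RLmax (proj₁ (decomp B)) × leftCount w F d ≡ RLmin (proj₂ (decomp B))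
  diagonal-block-statistics with final-stage
  ... | pending d∉ _ _ = ⊥-elim (d∉ (∈-strips⁺ d∈labels d-not-row))
  ... | placed X Y _ B≡ lastX Y<d ups lefts rewrite B≡ | decomp-split X Y d lastX Y<d =
    trans (cong lastL (sym (++-assoc X Y [ d ]))) (lastL-∷ʳ (X ++ Y) d) ,
    trans (upCount-diagonal Ld≡s1 (AllPairs.map (λ x>y → <⇒≢ x>y ∘ sym) strips-decreasing) columns∈strips) (sym ups) ,
    trans (leftCount-nonrow d-not-row) (sym lefts)
    where
    columns∈strips : ∀ {ℓ} → L ℓ ≡ s0 → ℓ ∈ strips
    columns∈strips Lℓ≡s0 =
      ∈-strips⁺ (Product.uncurry ∈-labels (letter-in-range w _ (letter≢ Lℓ≡s0 λ ()))) (letter≢ Lℓ≡s0 λ ())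

lemma4p11 : (n r : ℕ) → r ≤ n → (w : List Step) (F : Filling) → RATplus n r w F →
    (i : ℕ) → 1 ≤ i → i ≤ suc r →
    let d = nth 0 (diagonals w) i
        B = nth [] (blocks (insertionWord w F)) i
        X = proj₁ (decomp B)
        Y = proj₂ (decomp B)
    in (lastL B ≡ just d)
       × (upCount w F d ≡ RLmax X)
       × (leftCount w F d ≡ RLmin Y)
       × (upCount w F d + leftCount w F d ≡ RLmax X + RLmin Y)
lemma4p11 n r _ w F R (suc i′) _ i≤r+1 =
  let last , ups , lefts = diagonal-block-statistics in last , ups , lefts , cong₂ _+_ ups lefts
  where
  open DiagonalBlock (RATplus.isRAT R) (subst (suc i′ ≤_) (sym (trans (length-diagonals w) (RATplus.diagCount R))) i≤r+1)
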